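{- Let $O\subseteq Q$ be an order ideal of the type $(B_n,n)$ staircase poset $Q$ described in the context. An $\oplus$-diagram $D$ of shape $O$ is a $\Gamma$-diagram if and only if both of the following hold: (1) whenever a box $z$ with $D(z)=0$ lies above (same column, smaller row index) a box containing $+$, every box of $O$ to the left of $z$ (same row) contains $0$; (2) every diagonal box of $O$ containing $0$ has only $0$'s to its left (in its row).
   Context: $W$ is the Weyl group of type $B_n$ ($n\ge 2$) with simple reflections $s_1,\dots,s_n$, where $s_i s_{i+1}$ has order $3$ for $i\le n-2$, $s_{n-1}s_n$ has order $4$, and other pairs commute; Bruhat order $<$. $Q$ is the set of boxes $(r,c)$ with $1\le r\le n$ (rows numbered top to bottom) and $1\le c\le n-r+1$, box $(r,c)$ labeled $s_{(r,c)}=s_{r+c-1}$; the diagonal boxes are those with $c=n-r+1$ (labeled $s_n$). The order on $Q$ is the transitive closure of $(r,c)\lessdot(r,c+1)$ and $(r,c)\lessdot(r-1,c)$; order ideals are down-closed subsets. An $\oplus$-diagram of shape $O$ is a map $D:O\to\{0,+\}$. For a linear extension $b_1,\dots,b_m$ of $O$ set $s_{i_t}:=s_{b_{m+1-t}}$ (so $s_{i_1}\cdots s_{i_m}=s_{b_m}\cdots s_{b_1}$, a reduced word), and let $t_t=s_{i_t}$ if $D(b_{m+1-t})=0$, $t_t=1$ if $D(b_{m+1-t})=+$; $v_{(0)}=1$, $v_{(k)}=t_1\cdots t_k$. $D$ is a $\Gamma$-diagram if $v_{(k-1)}<v_{(k-1)}s_{i_k}$ for all $k=1,\dots,m$ (this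 does not depend on the linear extension). -}

module Defs where

open import Data.Nat using (ℕ; zero; suc; _≤_; _<_; _∸_; _+_; _<ᵇ_)
open import Data.Integer using (ℤ; +_; -_)
open import Data.List using (List; []; _∷_; foldl; applyUpTo; length; lookup; reverse)
open import Data.List.Relation.Unary.All using (All)
open import Data.List.Relation.Unary.Unique.Propositional using (Unique)
open import Data.List.Membership.Propositional using (_∈_)
open import Data.List.Relation.Binary.Sublist.Propositional using (_⊆_)
open import Data.Product using (_×_; Σ; ∃; _,_)
open import Data.Unit using (⊤)
open import Data.Bool using (if_then_else_)
open import Data.Fin as Fin using (Fin)
open import Relation.Binary.PropositionalEquality using (_≡_; _≢_)
open import Relation.Binary.Construct.Closure.Transitive using (TransClosure)
open import Function.Bundles using (_⇔_)

-- The Weyl group W(B_n), realised as signed permutations of {±1,…,±n}.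
-- An element w is stored by its window [w(1), …, w(n)] : List ℤ.
-- Right multiplication by s_i (1 ≤ i < n) swaps window positions i, i+1;
-- right multiplication by s_n negates window position n.
-- (So s_i s_{i+1} has order 3, s_{n-1} s_n order 4, others commute.)

Window : Set
Window = List ℤ

swapAt : ℕ → Window → Window
swapAt (suc zero) (x ∷ y ∷ xs) = y ∷ x ∷ xs
swapAt (suc (suc i)) (x ∷ xs) = x ∷ swapAt (suc i) xs
swapAt _ xs = xs

negAt : ℕ → Window → Window
negAt (suc zero) (x ∷ xs) = (- x) ∷ xs
negAt (suc (suc i)) (x ∷ xs) = x ∷ negAt (suc i) xs
negAt _ xs = xs

mulGen : ℕ → Window → ℕ → Window
mulGen n w i = if i <ᵇ n then swapAt i w else negAt n w

idW : ℕ → Window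
idW n = applyUpTo (λ j → + suc j) n

IsWord : ℕ → List ℕ → Set
IsWord n a = All (λ i → 1 ≤ i × i ≤ n) a

evalW : ℕ → List ℕ → Window
evalW n a = foldl (mulGen n) (idW n) a

IsReducedWordFor : ℕ → List ℕ → Window → Set
IsReducedWordFor n a w =
  IsWord n a × evalW n a ≡ w ×
  (∀ b → IsWord n b → evalW n b ≡ w → length a ≤ length b)

-- Bruhat order (subword characterisation):
-- u ≤ w iff some reduced word of w has a subword whose product is u.
_≤B[_]_ : Window → ℕ → Window → Set
u ≤B[ n ] w = Σ (List ℕ) λ a → IsReducedWordFor n a w ×
              Σ (List ℕ) λ a′ → a′ ⊆ a × evalW n a′ ≡ u

_<B[_]_ : Window → ℕ → Window → Set
u <B[ n ] w = u ≤B[ n ] w × u ≢ w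

Box : Set
Box = ℕ × ℕ   -- (row r, column c)

InQ : ℕ → Box → Set
InQ n (r , c) = 1 ≤ r × r ≤ n × 1 ≤ c × c ≤ n ∸ r + 1

label : Box → ℕ
label (r , c) = r + c ∸ 1

IsDiagonal : ℕ → Box → Set
IsDiagonal n (r , c) = c ≡ n ∸ r + 1

data Cover (n : ℕ) : Box → Box → Set where
  right : ∀ {r c} → InQ n (r , c) → InQ n (r , suc c) → Cover n (r , c) (r , suc c)
  up    : ∀ {r c} → InQ n (suc r , c) → InQ n (r , c) → Cover n (suc r , c) (r , c)

_<Q[_]_ : Box → ℕ → Box → Set
x <Q[ n ] y = TransClosure (Cover n) x y

IsOrderIdeal : ℕ → (Box → Set) → Set
IsOrderIdeal n O = (∀ b → O b → InQ n b) × (∀ x y → O y → x <Q[ n ] y → O x)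

IsLinearExt : ℕ → (Box → Set) → List Box → Set
IsLinearExt n O L =
  Unique L × (∀ b → (b ∈ L) ⇔ O b) ×
  (∀ (i j : Fin (length L)) → lookup L i <Q[ n ] lookup L j → i Fin.< j)

data Entry : Set where
  zer pls : Entry

-- Processes s_{i_1}, s_{i_2}, … (the boxes b_m, b_{m-1}, …) starting from v_(0).
GammaSteps : ℕ → (Box → Entry) → Window → List Box → Set
GammaSteps n D v [] = ⊤
GammaSteps n D v (b ∷ bs) =
  (v <B[ n ] mulGen n v (label b)) × GammaSteps n D (next (D b)) bs
  where
  next : Entry → Window
  next zer = mulGen n v (label b)
  next pls = v

IsΓDiagram : ℕ → (Box → Entry) → List Box → Set
IsΓDiagram n D L = GammaSteps n D (idW n) (reverse L)

Cond1 : ℕ → (Box → Set) → (Box → Entry) → Set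
Cond1 n O D = ∀ r r′ c → O (r , c) → D (r , c) ≡ zer →
  O (r′ , c) → r < r′ → D (r′ , c) ≡ pls →
  ∀ c′ → c′ < c → O (r , c′) → D (r , c′) ≡ zer

Cond2 : ℕ → (Box → Set) → (Box → Entry) → Set
Cond2 n O D = ∀ r c → O (r , c) → IsDiagonal n (r , c) → D (r , c) ≡ zer →
  ∀ c′ → c′ < c → O (r , c′) → D (r , c′) ≡ zer

module Submission where

-- Write v_(k) as a signed permutation and rank its values 1 < ⋯ < n < −n < ⋯ < −1. Counting
-- inversions gives ℓ(v s_p) = ℓ(v) ± 1, so the Γ-condition v < v s_p at a box labelled s_p says
-- that the value at position p has smaller rank than the value at p + 1 (for p = n: v(n) > 0).
-- Read the diagram as a wiring diagram fed with the identity: a 0 crosses the two wires of its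
-- box (on the diagonal it negates its wire), a + lets them pass. When a box is processed, the
-- values at positions p and p + 1 are those entering it from above and from the right; they only
-- depend on the boxes above and to the right of it, so the linear extension does not matter.
-- Sweeping the columns from right to left, the values entering a column from the right are
-- positive and increase downwards exactly in the rows with no blocked 0 further right (a 0 with
-- a + below it, or a diagonal 0), and a box is valid unless it is a + in a blocked row. This is
-- conditions (1) and (2).

open import Defs
open import Data.Nat using (ℕ; zero; suc; pred; _+_; _∸_; _≤_; _<_; z≤n; s≤s; _<ᵇ_; _≟_; _≤?_; _<?_)
open import Data.Nat.Properties
open import Data.Integer using (ℤ; +_; -[1+_]; -_; ∣_∣)
open import Data.Bool using (Bool; true; false; if_then_else_; T)
open import Data.Bool.Properties using (T-≡)
open import Data.Product using (_×_; Σ; _,_; proj₁; proj₂)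
open import Data.Sum using (_⊎_; inj₁; inj₂)
open import Data.Empty using (⊥; ⊥-elim)
open import Data.Unit using (⊤; tt)
open import Data.List using (List; []; _∷_; length)
open import Data.List.Relation.Unary.All using (All; []; _∷_)
open import Relation.Nullary using (Dec; yes; no; ¬_)
open import Relation.Binary.PropositionalEquality hiding ([_])
open import Function.Base using (id)
open import Function.Bundles using (_⇔_; mk⇔; Equivalence)
open import Function.Properties.Equivalence using () renaming (trans to ⇔-trans; sym to ⇔-sym)
open import Data.Product.Function.NonDependent.Propositional using (_×-⇔_)

≡⇒⇔ : {A B : Set} → A ≡ B → A ⇔ B
≡⇒⇔ refl = mk⇔ id id

×⇔All-∷ : {A : Set} {P : A → Set} {x : A} {xs : List A} → (P x × All P xs) ⇔ All P (x ∷ xs)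
×⇔All-∷ = mk⇔ (λ (px , pxs) → px ∷ pxs) (λ { (px ∷ pxs) → px , pxs })

true≢false : true ≢ false
true≢false ()

zer≢pls : zer ≢ pls
zer≢pls ()

≤⇒≡⊎< : ∀ {a b} → a ≤ b → a ≡ b ⊎ a < b
≤⇒≡⊎< le with m≤n⇒m<n∨m≡n le
... | inj₁ lt = inj₂ lt
... | inj₂ eq = inj₁ eq

<ᵇ-irrefl : ∀ k → (k <ᵇ k) ≡ false
<ᵇ-irrefl zero = refl
<ᵇ-irrefl (suc k) = <ᵇ-irrefl k

+-suc-∸1 : ∀ r c → 1 ≤ r → r + suc c ∸ 1 ≡ r + c
+-suc-∸1 (suc r) c _ = +-suc r c

≤-of-+ : ∀ a b a' b' → a + b ≤ a' + b' → a' ≤ a → b ≤ b'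
≤-of-+ a b a' b' le a'≤a = +-cancelˡ-≤ a' b b' (≤-trans (+-monoˡ-≤ b a'≤a) le)

if-cong : ∀ {A : Set} (b1 b2 : Bool) {x1 y1 x2 y2 : A} → b1 ≡ b2 →
  (b2 ≡ true → x1 ≡ x2) → (b2 ≡ false → y1 ≡ y2) → (if b1 then x1 else y1) ≡ (if b2 then x2 else y2)
if-cong true .true refl f g = f refl
if-cong false .false refl f g = g refl

byEntry : Entry → ℕ → ℕ → ℕ
byEntry zer a b = a
byEntry pls a b = b

mirror : ℕ → ℕ → ℕ
mirror n x = suc (n + n) ∸ x

mirror-n : ∀ n → mirror n n ≡ suc n
mirror-n n = trans (+-∸-assoc 1 (m≤m+n n n)) (cong suc (m+n∸n≡m n n))

n<mirror : ∀ n x → x ≤ n → n < mirror n x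
n<mirror n x le = ≤-trans (≤-reflexive (sym (mirror-n n))) (∸-monoʳ-≤ (suc (n + n)) le)

mirror≤n : ∀ n x → n < x → mirror n x ≤ n
mirror≤n n x lt = ≤-trans (∸-monoʳ-≤ (suc (n + n)) lt) (≤-reflexive (m+n∸n≡m n n))

module SignedPermutation (n : ℕ) where
  open import Data.Nat.Tactic.RingSolver using (solve-∀)
  open import Data.Integer.Properties using (∣-i∣≡∣i∣; neg-involutive)
  open import Data.List using (map; foldl; applyUpTo; _++_; [_])
  open import Data.List.Properties using (foldl-++; length-++)
  open import Data.List.Relation.Unary.All.Properties using (map⁺; map⁻; ++⁺)
  open import Data.List.Relation.Unary.AllPairs using ([]; _∷_)
  open import Data.List.Relation.Unary.Unique.Propositional using (Unique)
  open import Data.List.Relation.Binary.Sublist.Propositional using (⊆-refl)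
  open import Data.List.Relation.Binary.Sublist.Propositional.Properties using (length-mono-≤; ++⁺ʳ)

  rank : ℤ → ℕ
  rank (+ m) = m
  rank (-[1+ m ]) = n + n ∸ m

  InRange : ℤ → Set
  InRange (+ m) = 1 ≤ m × m ≤ n
  InRange (-[1+ m ]) = m < n

  𝟙 : {P : Set} → Dec P → ℕ
  𝟙 (yes _) = 1
  𝟙 (no _) = 0

  pairInv : ℤ → ℤ → ℕ
  pairInv x y = 𝟙 (rank y <? rank x) + 𝟙 (suc (n + n) <? rank x + rank y)

  pairInvs : ℤ → List ℤ → ℕ
  pairInvs x [] = 0
  pairInvs x (y ∷ ys) = pairInv x y + pairInvs x ys

  negCount : ℤ → ℕ
  negCount x = 𝟙 (n <? rank x)

  -- The length function of B_n: pairs i < j with w(i) > w(j) or w(i) + w(j) < 0, plus negative entries.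
  ℓ : List ℤ → ℕ
  ℓ [] = 0
  ℓ (x ∷ xs) = pairInvs x xs + negCount x + ℓ xs

  -- w(q), or the default d when q = 0 or q lies beyond the window.
  entryOr : List ℤ → ℕ → ℤ → ℤ
  entryOr [] q d = d
  entryOr (x ∷ xs) zero d = d
  entryOr (x ∷ xs) (suc zero) d = x
  entryOr (x ∷ xs) (suc (suc q)) d = entryOr xs (suc q) d

  entry : List ℤ → ℕ → ℤ
  entry w q = entryOr w q (+ q)

  ranks : List ℤ → ℕ → ℕ
  ranks w q = rank (entry w q)

  𝟙-yes : {P : Set} (d : Dec P) → P → 𝟙 d ≡ 1
  𝟙-yes (yes _) p = refl
  𝟙-yes (no ¬p) p = ⊥-elim (¬p p)

  𝟙-no : {P : Set} (d : Dec P) → ¬ P → 𝟙 d ≡ 0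
  𝟙-no (yes p) ¬p = ⊥-elim (¬p p)
  𝟙-no (no _) _ = refl

  𝟙≤1 : {P : Set} (d : Dec P) → 𝟙 d ≤ 1
  𝟙≤1 (yes _) = s≤s z≤n
  𝟙≤1 (no _) = z≤n

  𝟙-cong : {P Q : Set} (d : Dec P) (e : Dec Q) → (P → Q) → (Q → P) → 𝟙 d ≡ 𝟙 e
  𝟙-cong (yes p) (yes q) _ _ = refl
  𝟙-cong (yes p) (no ¬q) pq _ = ⊥-elim (¬q (pq p))
  𝟙-cong (no ¬p) (yes q) _ qp = ⊥-elim (¬p (qp q))
  𝟙-cong (no _) (no _) _ _ = refl

  overflow-comm : ∀ x y → 𝟙 (suc (n + n) <? rank x + rank y) ≡ 𝟙 (suc (n + n) <? rank y + rank x)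
  overflow-comm x y rewrite +-comm (rank x) (rank y) = refl

  pairInv-asc : ∀ x y → rank x < rank y → pairInv y x ≡ suc (pairInv x y)
  pairInv-asc x y lt
    rewrite 𝟙-yes (rank x <? rank y) lt | 𝟙-no (rank y <? rank x) (<⇒≯ lt) | overflow-comm y x = refl

  pairInv-≤ : ∀ x y → pairInv y x ≤ suc (pairInv x y)
  pairInv-≤ x y with rank x <? rank y | rank y <? rank x
  ... | yes _ | yes _ rewrite overflow-comm y x = n≤1+n _
  ... | yes _ | no _ rewrite overflow-comm y x = ≤-refl
  ... | no _ | yes _ rewrite overflow-comm y x = ≤-trans (n≤1+n _) (n≤1+n _)
  ... | no _ | no _ rewrite overflow-comm y x = n≤1+n _

  pairInvs-swapAt : ∀ x i ys → pairInvs x (swapAt i ys) ≡ pairInvs x ys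
  pairInvs-swapAt x zero ys = refl
  pairInvs-swapAt x (suc zero) [] = refl
  pairInvs-swapAt x (suc zero) (y ∷ []) = refl
  pairInvs-swapAt x (suc zero) (y ∷ z ∷ zs)
    rewrite sym (+-assoc (pairInv x z) (pairInv x y) (pairInvs x zs))
          | +-comm (pairInv x z) (pairInv x y) | +-assoc (pairInv x y) (pairInv x z) (pairInvs x zs) = refl
  pairInvs-swapAt x (suc (suc i)) [] = refl
  pairInvs-swapAt x (suc (suc i)) (y ∷ ys) = cong (λ z → pairInv x y + z) (pairInvs-swapAt x (suc i) ys)

  ℓ-swap-asc : ∀ i w d d' → 1 ≤ i → suc i ≤ length w →
    rank (entryOr w i d) < rank (entryOr w (suc i) d') → ℓ (swapAt i w) ≡ suc (ℓ w)
  ℓ-swap-asc (suc zero) (x ∷ y ∷ zs) d d' _ _ lt rewrite pairInv-asc x y lt = lem (pairInv x y) (pairInvs x zs) (pairInvs y zs) (negCount x) (negCount y) (ℓ zs)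
    where
    lem : ∀ a b c e g k → suc a + c + g + (b + e + k) ≡ suc (a + b + e + (c + g + k))
    lem = solve-∀
  ℓ-swap-asc (suc zero) (x ∷ []) d d' _ (s≤s ()) lt
  ℓ-swap-asc (suc (suc i)) (x ∷ ws) d d' _ (s≤s le) lt
    rewrite pairInvs-swapAt x (suc i) ws | ℓ-swap-asc (suc i) ws d d' (s≤s z≤n) le lt =
    +-suc (pairInvs x ws + negCount x) (ℓ ws)

  ℓ-swap-desc : ∀ i w d d' → 1 ≤ i → suc i ≤ length w →
    rank (entryOr w (suc i) d') < rank (entryOr w i d) → suc (ℓ (swapAt i w)) ≡ ℓ w
  ℓ-swap-desc (suc zero) (x ∷ y ∷ zs) d d' _ _ lt rewrite pairInv-asc y x lt = lem (pairInv y x) (pairInvs x zs) (pairInvs y zs) (negCount x) (negCount y) (ℓ zs)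
    where
    lem : ∀ a b c e g k → suc (a + c + g + (b + e + k)) ≡ suc a + b + e + (c + g + k)
    lem = solve-∀
  ℓ-swap-desc (suc zero) (x ∷ []) d d' _ (s≤s ()) lt
  ℓ-swap-desc (suc (suc i)) (x ∷ ws) d d' _ (s≤s le) lt
    rewrite pairInvs-swapAt x (suc i) ws | sym (ℓ-swap-desc (suc i) ws d d' (s≤s z≤n) le lt) =
    sym (+-suc (pairInvs x ws + negCount x) (ℓ (swapAt (suc i) ws)))

  ℓ-swap-le : ∀ i w → ℓ (swapAt i w) ≤ suc (ℓ w)
  ℓ-swap-le zero w = n≤1+n _
  ℓ-swap-le (suc zero) [] = z≤n
  ℓ-swap-le (suc zero) (x ∷ []) = n≤1+n _
  ℓ-swap-le (suc zero) (x ∷ y ∷ zs) =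
    ≤-trans (+-monoˡ-≤ _ (+-monoˡ-≤ _ (+-monoˡ-≤ _ (pairInv-≤ x y))))
            (≤-reflexive (lem (pairInv x y) (pairInvs x zs) (pairInvs y zs) (negCount x) (negCount y) (ℓ zs)))
    where
    lem : ∀ a b c e g k → suc a + c + g + (b + e + k) ≡ suc (a + b + e + (c + g + k))
    lem = solve-∀
  ℓ-swap-le (suc (suc i)) [] = z≤n
  ℓ-swap-le (suc (suc i)) (x ∷ ws) rewrite pairInvs-swapAt x (suc i) ws =
    ≤-trans (+-monoʳ-≤ (pairInvs x ws + negCount x) (ℓ-swap-le (suc i) ws))
            (≤-reflexive (+-suc (pairInvs x ws + negCount x) (ℓ ws)))

  rank-neg : ∀ y → InRange y → rank (- y) ≡ suc (n + n) ∸ rank y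
  rank-neg (+ suc m) _ = refl
  rank-neg (-[1+ m ]) m<n = sym (trans (+-∸-assoc 1 (m∸n≤m (n + n) m))
                                (cong suc (m∸[m∸n]≡n (≤-trans (<⇒≤ m<n) (m≤m+n n n)))))

  rank≤2n : ∀ y → InRange y → rank y ≤ n + n
  rank≤2n (+ suc m) (_ , le) = ≤-trans le (m≤m+n n n)
  rank≤2n (-[1+ m ]) _ = m∸n≤m (n + n) m

  InRange-neg : ∀ y → InRange y → InRange (- y)
  InRange-neg (+ suc m) (_ , le) = le
  InRange-neg (-[1+ m ]) lt = s≤s z≤n , lt

  pairInv-neg : ∀ x y → InRange y → pairInv x (- y) ≡ pairInv x y
  pairInv-neg x y iy rewrite rank-neg y iy =
    trans (cong₂ _+_ (𝟙-cong (suc (n + n) ∸ rank y <? rank x) (suc (n + n) <? rank x + rank y) a b)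
                     (𝟙-cong (suc (n + n) <? rank x + (suc (n + n) ∸ rank y)) (rank y <? rank x) c d))
          (+-comm (𝟙 (suc (n + n) <? rank x + rank y)) (𝟙 (rank y <? rank x)))
    where
    hy = rank≤2n y iy
    e : suc (n + n) ∸ rank y + rank y ≡ suc (n + n)
    e = m∸n+n≡m (≤-trans hy (n≤1+n _))
    a : suc (n + n) ∸ rank y < rank x → suc (n + n) < rank x + rank y
    a p = subst (_< rank x + rank y) e (+-monoˡ-< (rank y) p)
    b : suc (n + n) < rank x + rank y → suc (n + n) ∸ rank y < rank x
    b p = +-cancelʳ-< (rank y) _ _ (subst (_< rank x + rank y) (sym e) p)
    c : suc (n + n) < rank x + (suc (n + n) ∸ rank y) → rank y < rank x
    c p = ≰⇒> λ q → <⇒≱ p (subst (_≤ suc (n + n)) refl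
            (≤-trans (+-monoˡ-≤ _ q) (≤-reflexive (trans (+-comm (rank y) _) e))))
    d : rank y < rank x → suc (n + n) < rank x + (suc (n + n) ∸ rank y)
    d p = subst (_< rank x + (suc (n + n) ∸ rank y)) (trans (+-comm (rank y) _) e) (+-monoˡ-< _ p)

  pairInvs-negAt : ∀ x k ys → All InRange ys → pairInvs x (negAt k ys) ≡ pairInvs x ys
  pairInvs-negAt x zero ys _ = refl
  pairInvs-negAt x (suc zero) [] _ = refl
  pairInvs-negAt x (suc zero) (y ∷ ys) (iy ∷ _) = cong (_+ pairInvs x ys) (pairInv-neg x y iy)
  pairInvs-negAt x (suc (suc k)) [] _ = refl
  pairInvs-negAt x (suc (suc k)) (y ∷ ys) (_ ∷ a) = cong (λ z → pairInv x y + z) (pairInvs-negAt x (suc k) ys a)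

  negCount-pos : ∀ y → InRange y → rank y ≤ n → negCount y ≡ 0 × negCount (- y) ≡ 1
  negCount-pos y iy le = 𝟙-no (n <? rank y) (≤⇒≯ le) ,
    𝟙-yes (n <? rank (- y)) (subst (n <_) (sym (rank-neg y iy)) (n<mirror n (rank y) le))

  negCount-neg : ∀ y → InRange y → n < rank y → negCount y ≡ 1 × negCount (- y) ≡ 0
  negCount-neg y iy lt = 𝟙-yes (n <? rank y) lt , 𝟙-no (n <? rank (- y)) λ p → <⇒≱ p (subst (_≤ n) (sym (rank-neg y iy)) (mirror≤n n (rank y) lt))

  ℓ-negAt : ∀ k w d → length w ≡ k → 1 ≤ k → All InRange w →
    ℓ (negAt k w) + negCount (entryOr w k d) ≡ ℓ w + negCount (- entryOr w k d)
  ℓ-negAt (suc zero) (x ∷ []) d _ _ _ = lem (negCount x) (negCount (- x))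
    where
    lem : ∀ a b → b + 0 + a ≡ a + 0 + b
    lem = solve-∀
  ℓ-negAt (suc (suc k)) (x ∷ ws) d eq _ (_ ∷ a)
    rewrite pairInvs-negAt x (suc k) ws a =
    trans (+-assoc (pairInvs x ws + negCount x) _ _)
     (trans (cong (λ z → pairInvs x ws + negCount x + z) (ℓ-negAt (suc k) ws d (suc-injective eq) (s≤s z≤n) a))
       (sym (+-assoc (pairInvs x ws + negCount x) _ _)))

  IsSignedPerm : List ℤ → Set
  IsSignedPerm w = length w ≡ n × All InRange w × Unique (map ∣_∣ w)

  All-entryOr : ∀ {P : ℤ → Set} w q d → All P w → 1 ≤ q → q ≤ length w → P (entryOr w q d)
  All-entryOr (x ∷ w) (suc zero) d (p ∷ _) _ _ = p
  All-entryOr (x ∷ w) (suc (suc q)) d (_ ∷ ps) _ (s≤s le) = All-entryOr w (suc q) d ps (s≤s z≤n) le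

  rank-injective : ∀ x y → InRange x → InRange y → rank x ≡ rank y → x ≡ y
  rank-injective (+ a) (+ b) _ _ refl = refl
  rank-injective (+ a) (-[1+ b ]) (_ , le) lt eq = ⊥-elim (<⇒≱ (subst (n <_) (sym eq) (n<mirror n (suc b) lt)) le)
  rank-injective (-[1+ a ]) (+ b) la (_ , le) eq = ⊥-elim (<⇒≱ (subst (n <_) eq (n<mirror n (suc a) la)) le)
  rank-injective (-[1+ a ]) (-[1+ b ]) la lb eq =
    cong -[1+_] (∸-cancelˡ-≡ (≤-trans (<⇒≤ la) (m≤m+n n n)) (≤-trans (<⇒≤ lb) (m≤m+n n n)) eq)

  rank-adjacent-≢ : ∀ w i d d' → All InRange w → Unique (map ∣_∣ w) → 1 ≤ i → suc i ≤ length w →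
    rank (entryOr w i d) ≢ rank (entryOr w (suc i) d')
  rank-adjacent-≢ (x ∷ y ∷ w) (suc zero) d d' (ix ∷ iy ∷ _) ((nxy ∷ _) ∷ _) _ _ eq =
    nxy (cong ∣_∣ (rank-injective x y ix iy eq))
  rank-adjacent-≢ (x ∷ w) (suc (suc i)) d d' (_ ∷ a) (_ ∷ u) _ (s≤s le) =
    rank-adjacent-≢ w (suc i) d d' a u (s≤s z≤n) le

  length-swapAt : ∀ i (w : List ℤ) → length (swapAt i w) ≡ length w
  length-swapAt zero w = refl
  length-swapAt (suc zero) [] = refl
  length-swapAt (suc zero) (x ∷ []) = refl
  length-swapAt (suc zero) (x ∷ y ∷ w) = refl
  length-swapAt (suc (suc i)) [] = refl
  length-swapAt (suc (suc i)) (x ∷ w) = cong suc (length-swapAt (suc i) w)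

  length-negAt : ∀ i (w : List ℤ) → length (negAt i w) ≡ length w
  length-negAt zero w = refl
  length-negAt (suc zero) [] = refl
  length-negAt (suc zero) (x ∷ w) = refl
  length-negAt (suc (suc i)) [] = refl
  length-negAt (suc (suc i)) (x ∷ w) = cong suc (length-negAt (suc i) w)

  All-swapAt : ∀ {P : ℤ → Set} i w → All P w → All P (swapAt i w)
  All-swapAt zero w a = a
  All-swapAt (suc zero) [] a = a
  All-swapAt (suc zero) (x ∷ []) a = a
  All-swapAt (suc zero) (x ∷ y ∷ w) (px ∷ py ∷ a) = py ∷ px ∷ a
  All-swapAt (suc (suc i)) [] a = a
  All-swapAt (suc (suc i)) (x ∷ w) (px ∷ a) = px ∷ All-swapAt (suc i) w a

  All-negAt : ∀ {P : ℤ → Set} i w → (∀ x → P x → P (- x)) → All P w → All P (negAt i w)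
  All-negAt zero w _ a = a
  All-negAt (suc zero) [] _ a = a
  All-negAt (suc zero) (x ∷ w) g (px ∷ a) = g x px ∷ a
  All-negAt (suc (suc i)) [] _ a = a
  All-negAt (suc (suc i)) (x ∷ w) g (px ∷ a) = px ∷ All-negAt (suc i) w g a

  map-∣∣-negAt : ∀ i w → map ∣_∣ (negAt i w) ≡ map ∣_∣ w
  map-∣∣-negAt zero w = refl
  map-∣∣-negAt (suc zero) [] = refl
  map-∣∣-negAt (suc zero) (x ∷ w) = cong (_∷ map ∣_∣ w) (∣-i∣≡∣i∣ x)
  map-∣∣-negAt (suc (suc i)) [] = refl
  map-∣∣-negAt (suc (suc i)) (x ∷ w) = cong (∣ x ∣ ∷_) (map-∣∣-negAt (suc i) w)

  Unique-swapAt : ∀ i w → Unique (map ∣_∣ w) → Unique (map ∣_∣ (swapAt i w))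
  Unique-swapAt zero w u = u
  Unique-swapAt (suc zero) [] u = u
  Unique-swapAt (suc zero) (x ∷ []) u = u
  Unique-swapAt (suc zero) (x ∷ y ∷ w) ((nxy ∷ ax) ∷ ay ∷ u) = ((λ e → nxy (sym e)) ∷ ay) ∷ ax ∷ u
  Unique-swapAt (suc (suc i)) [] u = u
  Unique-swapAt (suc (suc i)) (x ∷ w) (ax ∷ u) =
    map⁺ (All-swapAt (suc i) w (map⁻ ax)) ∷ Unique-swapAt (suc i) w u

  swapAt-involutive : ∀ i (w : List ℤ) → swapAt i (swapAt i w) ≡ w
  swapAt-involutive zero w = refl
  swapAt-involutive (suc zero) [] = refl
  swapAt-involutive (suc zero) (x ∷ []) = refl
  swapAt-involutive (suc zero) (x ∷ y ∷ w) = refl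
  swapAt-involutive (suc (suc i)) [] = refl
  swapAt-involutive (suc (suc i)) (x ∷ w) = cong (x ∷_) (swapAt-involutive (suc i) w)

  negAt-involutive : ∀ i (w : List ℤ) → negAt i (negAt i w) ≡ w
  negAt-involutive zero w = refl
  negAt-involutive (suc zero) [] = refl
  negAt-involutive (suc zero) (x ∷ w) = cong (_∷ w) (neg-involutive x)
  negAt-involutive (suc (suc i)) [] = refl
  negAt-involutive (suc (suc i)) (x ∷ w) = cong (x ∷_) (negAt-involutive (suc i) w)

  Ascent : List ℤ → ℕ → Set
  Ascent w i = if i <ᵇ n then rank (entry w i) < rank (entry w (suc i)) else rank (entry w n) ≤ n

  <ᵇ-true : ∀ i → (i <ᵇ n) ≡ true → i < n
  <ᵇ-true i eq = <ᵇ⇒< i n (subst T (sym eq) _)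

  <ᵇ-false : ∀ i → i ≤ n → (i <ᵇ n) ≡ false → i ≡ n
  <ᵇ-false i le eq with m≤n⇒m<n∨m≡n le
  ... | inj₂ e = e
  ... | inj₁ lt with <⇒<ᵇ lt
  ...   | t rewrite eq = ⊥-elim t

  mulGen-involutive : ∀ w i → mulGen n (mulGen n w i) i ≡ w
  mulGen-involutive w i with i <ᵇ n
  ... | true = swapAt-involutive i w
  ... | false = negAt-involutive n w

  IsSignedPerm-mulGen : ∀ w i → IsSignedPerm w → IsSignedPerm (mulGen n w i)
  IsSignedPerm-mulGen w i (len , a , u) with i <ᵇ n
  ... | true = trans (length-swapAt i w) len , All-swapAt i w a , Unique-swapAt i w u
  ... | false = trans (length-negAt n w) len , All-negAt n w InRange-neg a ,
                subst Unique (sym (map-∣∣-negAt n w)) u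

  ℓ-mulGen-ascent : ∀ w i → IsSignedPerm w → 1 ≤ i → i ≤ n → Ascent w i → ℓ (mulGen n w i) ≡ suc (ℓ w)
  ℓ-mulGen-ascent w i (len , a , u) 1≤i i≤n asc with i <ᵇ n in eq
  ... | true = ℓ-swap-asc i w (+ i) (+ suc i) 1≤i (subst (suc i ≤_) (sym len) (<ᵇ-true i eq)) asc
  ... | false with <ᵇ-false i i≤n eq
  ...   | refl = +-cancelʳ-≡ _ _ _ (trans e (trans (cong₂ _+_ refl n1) (trans (+-comm (ℓ w) 1)
                   (sym (trans (cong₂ _+_ refl n0) (+-identityʳ _))))))
    where
    iy = All-entryOr w i (+ i) a 1≤i (≤-reflexive (sym len))
    e = ℓ-negAt i w (+ i) len 1≤i a
    n0 = proj₁ (negCount-pos (entry w i) iy asc)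
    n1 = proj₂ (negCount-pos (entry w i) iy asc)

  ℓ-mulGen-descent : ∀ w i → IsSignedPerm w → 1 ≤ i → i ≤ n → ¬ Ascent w i → suc (ℓ (mulGen n w i)) ≡ ℓ w
  ℓ-mulGen-descent w i (len , a , u) 1≤i i≤n nasc with i <ᵇ n in eq
  ... | true = ℓ-swap-desc i w (+ i) (+ suc i) 1≤i le
                 (≤∧≢⇒< (≮⇒≥ nasc) λ e → rank-adjacent-≢ w i (+ i) (+ suc i) a u 1≤i le (sym e))
    where le = subst (suc i ≤_) (sym len) (<ᵇ-true i eq)
  ... | false with <ᵇ-false i i≤n eq
  ...   | refl = trans (+-comm 1 (ℓ (negAt i w))) (trans (cong₂ _+_ refl (sym n1))
                   (trans e (trans (cong₂ _+_ refl n0) (+-identityʳ _))))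
    where
    iy = All-entryOr w i (+ i) a 1≤i (≤-reflexive (sym len))
    e = ℓ-negAt i w (+ i) len 1≤i a
    n1 = proj₁ (negCount-neg (entry w i) iy (≰⇒> nasc))
    n0 = proj₂ (negCount-neg (entry w i) iy (≰⇒> nasc))

  negAt-[] : ∀ k → negAt k [] ≡ []
  negAt-[] zero = refl
  negAt-[] (suc zero) = refl
  negAt-[] (suc (suc k)) = refl

  ℓ-mulGen-≤ : ∀ w i → IsSignedPerm w → ℓ (mulGen n w i) ≤ suc (ℓ w)
  ℓ-mulGen-≤ w i (len , a , u) with i <ᵇ n
  ... | true = ℓ-swap-le i w
  ℓ-mulGen-≤ [] i (len , a , u) | false rewrite negAt-[] n = z≤n
  ℓ-mulGen-≤ (x ∷ w') i (len , a , u) | false = +-cancelʳ-≤ (negCount e) _ _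
    (≤-trans (≤-reflexive (ℓ-negAt n (x ∷ w') (+ n) len 1≤n a))
      (≤-trans (+-monoʳ-≤ (ℓ (x ∷ w')) (𝟙≤1 (n <? rank (- e)))) (≤-trans (≤-reflexive (+-comm (ℓ (x ∷ w')) 1)) (m≤m+n _ _))))
    where
    e = entryOr (x ∷ w') n (+ n)
    1≤n : 1 ≤ n
    1≤n = subst (1 ≤_) len (s≤s z≤n)

  upFrom : ℕ → ℕ → List ℤ
  upFrom a zero = []
  upFrom a (suc m) = + suc a ∷ upFrom (suc a) m

  applyUpTo≡upFrom : ∀ (g : ℕ → ℤ) a m → (∀ j → g j ≡ + suc (a + j)) → applyUpTo g m ≡ upFrom a m
  applyUpTo≡upFrom g a zero _ = refl
  applyUpTo≡upFrom g a (suc m) eq =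
    cong₂ _∷_ (trans (eq 0) (cong (λ z → + suc z) (+-identityʳ a)))
              (applyUpTo≡upFrom (λ j → g (suc j)) (suc a) m (λ j → trans (eq (suc j)) (cong (λ z → + suc z) (+-suc a j))))

  idW≡upFrom : idW n ≡ upFrom 0 n
  idW≡upFrom = applyUpTo≡upFrom (λ j → + suc j) 0 n (λ j → refl)

  upFrom-bound : ∀ b m → b + suc m ≤ n → b < n
  upFrom-bound b m le = ≤-trans (s≤s (m≤m+n b m)) (≤-trans (≤-reflexive (sym (+-suc b m))) le)

  upFrom-noOverflow : ∀ a b → a < b → b < n → suc a + suc b ≤ suc (n + n)
  upFrom-noOverflow a b a<b b<n = ≤-trans (+-mono-≤ (<-trans a<b b<n) b<n) (n≤1+n _)

  pairInvs-upFrom : ∀ a b m → a < b → b + m ≤ n → pairInvs (+ suc a) (upFrom b m) ≡ 0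
  pairInvs-upFrom a b zero _ _ = refl
  pairInvs-upFrom a b (suc m) a<b le
    rewrite 𝟙-no (suc b <? suc a) (λ p → <-asym (s≤s a<b) p)
          | 𝟙-no (suc (n + n) <? suc a + suc b) (λ p → <⇒≱ p (upFrom-noOverflow a b a<b (upFrom-bound b m le))) =
    pairInvs-upFrom a (suc b) m (≤-trans a<b (n≤1+n b)) (≤-trans (≤-reflexive (sym (+-suc b m))) le)

  ℓ-upFrom : ∀ a m → a + m ≤ n → ℓ (upFrom a m) ≡ 0
  ℓ-upFrom a zero _ = refl
  ℓ-upFrom a (suc m) le
    rewrite pairInvs-upFrom a (suc a) m ≤-refl (≤-trans (≤-reflexive (sym (+-suc a m))) le)
          | 𝟙-no (n <? suc a) (≤⇒≯ (≤-trans (s≤s (m≤m+n a m)) (≤-trans (≤-reflexive (sym (+-suc a m))) le)))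
    = ℓ-upFrom (suc a) m (≤-trans (≤-reflexive (sym (+-suc a m))) le)

  ℓ-idW : ℓ (idW n) ≡ 0
  ℓ-idW rewrite idW≡upFrom = ℓ-upFrom 0 n ≤-refl

  length-upFrom : ∀ a m → length (upFrom a m) ≡ m
  length-upFrom a zero = refl
  length-upFrom a (suc m) = cong suc (length-upFrom (suc a) m)

  InRange-upFrom : ∀ a m → a + m ≤ n → All InRange (upFrom a m)
  InRange-upFrom a zero _ = []
  InRange-upFrom a (suc m) le = (s≤s z≤n , ≤-trans (s≤s (m≤m+n a m)) le') ∷ InRange-upFrom (suc a) m le'
    where le' = ≤-trans (≤-reflexive (sym (+-suc a m))) le

  upFrom-fresh : ∀ a b m → a < b → All (suc a ≢_) (map ∣_∣ (upFrom b m))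
  upFrom-fresh a b zero _ = []
  upFrom-fresh a b (suc m) lt = (λ e → <-irrefl (cong pred e) lt) ∷ upFrom-fresh a (suc b) m (≤-trans lt (n≤1+n b))

  Unique-upFrom : ∀ a m → Unique (map ∣_∣ (upFrom a m))
  Unique-upFrom a zero = []
  Unique-upFrom a (suc m) = upFrom-fresh a (suc a) m ≤-refl ∷ Unique-upFrom (suc a) m

  IsSignedPerm-idW : IsSignedPerm (idW n)
  IsSignedPerm-idW rewrite idW≡upFrom = length-upFrom 0 n , InRange-upFrom 0 n ≤-refl , Unique-upFrom 0 n

  entryOr-upFrom : ∀ a k q → entryOr (upFrom a k) q (+ (a + q)) ≡ + (a + q)
  entryOr-upFrom a zero q = refl
  entryOr-upFrom a (suc k) zero = refl
  entryOr-upFrom a (suc k) (suc zero) = cong +_ (sym (trans (+-suc a 0) (cong suc (+-identityʳ a))))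
  entryOr-upFrom a (suc k) (suc (suc q)) rewrite +-suc a (suc q) = entryOr-upFrom (suc a) k (suc q)

  ranks-idW : ∀ q → ranks (idW n) q ≡ q
  ranks-idW q rewrite idW≡upFrom = cong rank (entryOr-upFrom 0 n q)

  ascent⇒< : ∀ w i → i < n → Ascent w i → rank (entry w i) < rank (entry w (suc i))
  ascent⇒< w i lt a with i <ᵇ n in eq
  ... | true = a
  ... | false with <⇒<ᵇ lt
  ...   | t rewrite eq = ⊥-elim t

  ascent⇒positive : ∀ w → Ascent w n → rank (entry w n) ≤ n
  ascent⇒positive w a with n <ᵇ n in eq
  ... | true = ⊥-elim (<-irrefl refl (<ᵇ-true n eq))
  ... | false = a

  1≤rank : ∀ x → InRange x → 1 ≤ rank x
  1≤rank (+ m) (le , _) = le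
  1≤rank (-[1+ m ]) lt = ≤-trans (s≤s z≤n) (n<mirror n (suc m) lt)

  rank≤n⇒≡+ : ∀ x i → InRange x → rank x ≡ i → i ≤ n → x ≡ + i
  rank≤n⇒≡+ (+ m) i _ refl _ = refl
  rank≤n⇒≡+ (-[1+ m ]) i lt refl le = ⊥-elim (<⇒≱ (n<mirror n (suc m) lt) le)

  upFrom-ext : ∀ (dflt : ℕ → ℤ) a w → (∀ q → 1 ≤ q → q ≤ length w → entryOr w q (dflt q) ≡ + (a + q)) →
    w ≡ upFrom a (length w)
  upFrom-ext dflt a [] _ = refl
  upFrom-ext dflt a (x ∷ w) H =
    cong₂ _∷_ (trans (H 1 (s≤s z≤n) (s≤s z≤n)) (cong +_ (+-comm a 1)))
      (upFrom-ext (λ q → dflt (suc q)) (suc a) w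
        λ { zero () _ ; (suc q) _ le → trans (H (suc (suc q)) (s≤s z≤n) (s≤s le)) (cong +_ (+-suc a (suc q))) })

  allAscents⇒idW : ∀ w → IsSignedPerm w → (∀ i → 1 ≤ i → i ≤ n → Ascent w i) → w ≡ idW n
  allAscents⇒idW w (len , a , u) H = trans (upFrom-ext (λ q → + q) 0 w λ q 1≤q q≤ → rank≤n⇒≡+ _ q (iR q 1≤q (subst (q ≤_) len q≤)) (hq q 1≤q (subst (q ≤_) len q≤)) (subst (q ≤_) len q≤))
                                       (trans (cong (upFrom 0) len) (sym idW≡upFrom))
    where
    iR : ∀ q → 1 ≤ q → q ≤ n → InRange (entry w q)
    iR q 1≤q q≤n = All-entryOr w q (+ q) a 1≤q (subst (q ≤_) (sym len) q≤n)
    lo : ∀ q → 1 ≤ q → q ≤ n → q ≤ rank (entry w q)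
    lo (suc zero) _ q≤n = 1≤rank _ (iR 1 (s≤s z≤n) q≤n)
    lo (suc (suc q)) _ q≤n =
      ≤-trans (s≤s (lo (suc q) (s≤s z≤n) (<⇒≤ q≤n)))
              (ascent⇒< w (suc q) q≤n (H (suc q) (s≤s z≤n) (<⇒≤ q≤n)))
    upb : ∀ k q → q + k ≡ n → 1 ≤ q → rank (entry w q) ≤ q
    upb zero q e 1≤q = subst (λ z → rank (entry w z) ≤ z) (sym qn) (ascent⇒positive w (H n (subst (1 ≤_) qn 1≤q) ≤-refl))
      where
      qn : q ≡ n
      qn = trans (sym (+-identityʳ q)) e
    upb (suc k) q e 1≤q = ≤-pred (≤-trans (ascent⇒< w q q<n (H q 1≤q (<⇒≤ q<n))) (upb k (suc q) (trans (sym (+-suc q k)) e) (s≤s z≤n)))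
      where
      q<n : q < n
      q<n = subst (q <_) e (≤-trans (s≤s (m≤m+n q k)) (≤-reflexive (sym (+-suc q k))))
    hq : ∀ q → 1 ≤ q → q ≤ n → rank (entry w q) ≡ q
    hq q 1≤q q≤n = ≤-antisym (upb (n ∸ q) q (m+[n∸m]≡n q≤n) 1≤q) (lo q 1≤q q≤n)

  boundedSearch : (P : ℕ → Set) → (∀ i → Dec (P i)) → ∀ m →
    (∀ i → 1 ≤ i → i ≤ m → P i) ⊎ Σ ℕ (λ i → 1 ≤ i × i ≤ m × ¬ P i)
  boundedSearch P d zero = inj₁ λ { zero () _ ; (suc i) _ () }
  boundedSearch P d (suc m) with boundedSearch P d m | d (suc m)
  ... | inj₂ (i , a , b , c) | _ = inj₂ (i , a , ≤-trans b (n≤1+n m) , c)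
  ... | inj₁ _ | no np = inj₂ (suc m , s≤s z≤n , ≤-refl , np)
  ... | inj₁ all | yes p = inj₁ λ i 1≤i i≤ → belowOrLast i 1≤i (m≤n⇒m<n∨m≡n i≤)
    where
    belowOrLast : ∀ i → 1 ≤ i → i < suc m ⊎ i ≡ suc m → P i
    belowOrLast i 1≤i (inj₁ lt) = all i 1≤i (≤-pred lt)
    belowOrLast i 1≤i (inj₂ refl) = p

  Ascent? : ∀ w i → Dec (Ascent w i)
  Ascent? w i with i <ᵇ n
  ... | true = rank (entry w i) <? rank (entry w (suc i))
  ... | false = rank (entry w n) ≤? n

  evalW-∷ʳ : ∀ a i → evalW n (a ++ [ i ]) ≡ mulGen n (evalW n a) i
  evalW-∷ʳ a i = foldl-++ (mulGen n) (idW n) a [ i ]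

  IsSignedPerm-foldl : ∀ b w → IsSignedPerm w → IsSignedPerm (foldl (mulGen n) w b)
  IsSignedPerm-foldl [] w sp = sp
  IsSignedPerm-foldl (i ∷ b) w sp = IsSignedPerm-foldl b (mulGen n w i) (IsSignedPerm-mulGen w i sp)

  ℓ-foldl-≤ : ∀ b w → IsSignedPerm w → ℓ (foldl (mulGen n) w b) ≤ ℓ w + length b
  ℓ-foldl-≤ [] w sp = m≤m+n _ _
  ℓ-foldl-≤ (i ∷ b) w sp =
    ≤-trans (ℓ-foldl-≤ b (mulGen n w i) (IsSignedPerm-mulGen w i sp))
      (≤-trans (+-monoˡ-≤ (length b) (ℓ-mulGen-≤ w i sp)) (≤-reflexive (sym (+-suc (ℓ w) (length b)))))

  ℓ-evalW-≤ : ∀ b → ℓ (evalW n b) ≤ length b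
  ℓ-evalW-≤ b = subst (λ z → ℓ (evalW n b) ≤ z + length b) ℓ-idW (ℓ-foldl-≤ b (idW n) IsSignedPerm-idW)

  reducedWordOfLength : ∀ k w → IsSignedPerm w → ℓ w ≡ k →
    Σ (List ℕ) λ b → IsWord n b × evalW n b ≡ w × length b ≡ k
  reducedWordOfLength k w sp eq with boundedSearch (Ascent w) (Ascent? w) n
  ... | inj₁ all = [] , [] , sym (allAscents⇒idW w sp all) , trans (sym ℓ-idW) (trans (cong ℓ (sym (allAscents⇒idW w sp all))) eq)
  reducedWordOfLength zero w sp eq | inj₂ (i , 1≤i , i≤n , na) with ℓ-mulGen-descent w i sp 1≤i i≤n na
  ... | e = ⊥-elim (1+n≢0 (trans e eq))
  reducedWordOfLength (suc k) w sp eq | inj₂ (i , 1≤i , i≤n , na)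
    with reducedWordOfLength k (mulGen n w i) (IsSignedPerm-mulGen w i sp) (suc-injective (trans (ℓ-mulGen-descent w i sp 1≤i i≤n na) eq))
  ... | b , wb , eb , lb =
    b ++ [ i ] , ++⁺ wb ((1≤i , i≤n) ∷ []) ,
    trans (evalW-∷ʳ b i) (trans (cong (λ z → mulGen n z i) eb) (mulGen-involutive w i)) ,
    trans (length-++ b) (trans (+-comm (length b) 1) (cong suc lb))

  -- Both directions compare lengths: ℓ(evalW a) ≤ length a for every word a, and
  -- ℓ(v s_i) = ℓ(v) + 1 or ℓ(v) − 1 according as i is an ascent of v or not.
  bruhatCover⇔ascent : ∀ v i → IsSignedPerm v → 1 ≤ i → i ≤ n → (v <B[ n ] mulGen n v i) ⇔ Ascent v i
  bruhatCover⇔ascent v i sp 1≤i i≤n = mk⇔ to from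
    where
    to : v <B[ n ] mulGen n v i → Ascent v i
    to ((a , (wa , ea , minA) , a' , sub , ea') , neq) with Ascent? v i
    ... | yes p = p
    ... | no np with reducedWordOfLength (ℓ (mulGen n v i)) (mulGen n v i) (IsSignedPerm-mulGen v i sp) refl
    ...   | b , wb , eb , lb = ⊥-elim (<-irrefl refl (≤-trans (≤-reflexive (ℓ-mulGen-descent v i sp 1≤i i≤n np)) chain))
      where
      chain : ℓ v ≤ ℓ (mulGen n v i)
      chain = ≤-trans (≤-reflexive (cong ℓ (sym ea'))) (≤-trans (ℓ-evalW-≤ a')
                (≤-trans (length-mono-≤ sub) (≤-trans (minA b wb eb) (≤-reflexive lb))))
    from : Ascent v i → v <B[ n ] mulGen n v i
    from asc with reducedWordOfLength (ℓ v) v sp refl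
    ... | a , wa , ea , la =
      (a ++ [ i ] , (++⁺ wa ((1≤i , i≤n) ∷ []) , trans (evalW-∷ʳ a i) (cong (λ z → mulGen n z i) ea) , mini) ,
       a , ++⁺ʳ [ i ] ⊆-refl , ea) ,
      λ e → <-irrefl (cong ℓ e) (≤-reflexive (sym (ℓ-mulGen-ascent v i sp 1≤i i≤n asc)))
      where
      mini : ∀ b → IsWord n b → evalW n b ≡ mulGen n v i → length (a ++ [ i ]) ≤ length b
      mini b wb eb = ≤-trans (≤-reflexive (trans (length-++ a) (trans (+-comm (length a) 1) (cong suc la))))
                       (≤-trans (≤-reflexive (sym (ℓ-mulGen-ascent v i sp 1≤i i≤n asc)))
                         (subst (λ z → ℓ z ≤ length b) eb (ℓ-evalW-≤ b)))

  entryOr-swapAt-other : ∀ i w q d → q ≢ i → q ≢ suc i → entryOr (swapAt i w) q d ≡ entryOr w q d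
  entryOr-swapAt-other zero w q d _ _ = refl
  entryOr-swapAt-other (suc zero) [] q d _ _ = refl
  entryOr-swapAt-other (suc zero) (x ∷ []) q d _ _ = refl
  entryOr-swapAt-other (suc zero) (x ∷ y ∷ w) zero d _ _ = refl
  entryOr-swapAt-other (suc zero) (x ∷ y ∷ w) (suc zero) d n1 _ = ⊥-elim (n1 refl)
  entryOr-swapAt-other (suc zero) (x ∷ y ∷ w) (suc (suc zero)) d _ n2 = ⊥-elim (n2 refl)
  entryOr-swapAt-other (suc zero) (x ∷ y ∷ w) (suc (suc (suc q))) d _ _ = refl
  entryOr-swapAt-other (suc (suc i)) [] q d _ _ = refl
  entryOr-swapAt-other (suc (suc i)) (x ∷ w) zero d _ _ = refl
  entryOr-swapAt-other (suc (suc i)) (x ∷ w) (suc zero) d _ _ = refl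
  entryOr-swapAt-other (suc (suc i)) (x ∷ w) (suc (suc q)) d n1 n2 =
    entryOr-swapAt-other (suc i) w (suc q) d (λ e → n1 (cong suc e)) (λ e → n2 (cong suc e))

  entryOr-swapAt-left : ∀ i w d d' → 1 ≤ i → suc i ≤ length w → entryOr (swapAt i w) i d ≡ entryOr w (suc i) d'
  entryOr-swapAt-left (suc zero) (x ∷ y ∷ w) d d' _ _ = refl
  entryOr-swapAt-left (suc zero) (x ∷ []) d d' _ (s≤s ())
  entryOr-swapAt-left (suc (suc i)) (x ∷ w) d d' _ (s≤s le) = entryOr-swapAt-left (suc i) w d d' (s≤s z≤n) le

  entryOr-swapAt-right : ∀ i w d d' → 1 ≤ i → suc i ≤ length w → entryOr (swapAt i w) (suc i) d ≡ entryOr w i d'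
  entryOr-swapAt-right (suc zero) (x ∷ y ∷ w) d d' _ _ = refl
  entryOr-swapAt-right (suc zero) (x ∷ []) d d' _ (s≤s ())
  entryOr-swapAt-right (suc (suc i)) (x ∷ w) d d' _ (s≤s le) = entryOr-swapAt-right (suc i) w d d' (s≤s z≤n) le

  entryOr-negAt-other : ∀ i w q d → q ≢ i → entryOr (negAt i w) q d ≡ entryOr w q d
  entryOr-negAt-other zero w q d _ = refl
  entryOr-negAt-other (suc zero) [] q d _ = refl
  entryOr-negAt-other (suc zero) (x ∷ w) zero d _ = refl
  entryOr-negAt-other (suc zero) (x ∷ w) (suc zero) d n1 = ⊥-elim (n1 refl)
  entryOr-negAt-other (suc zero) (x ∷ w) (suc (suc q)) d _ = refl
  entryOr-negAt-other (suc (suc i)) [] q d _ = refl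
  entryOr-negAt-other (suc (suc i)) (x ∷ w) zero d _ = refl
  entryOr-negAt-other (suc (suc i)) (x ∷ w) (suc zero) d _ = refl
  entryOr-negAt-other (suc (suc i)) (x ∷ w) (suc (suc q)) d n1 = entryOr-negAt-other (suc i) w (suc q) d (λ e → n1 (cong suc e))

  entryOr-negAt-self : ∀ i w d → 1 ≤ i → i ≤ length w → entryOr (negAt i w) i d ≡ - entryOr w i d
  entryOr-negAt-self (suc zero) (x ∷ w) d _ _ = refl
  entryOr-negAt-self (suc (suc i)) (x ∷ w) d _ (s≤s le) = entryOr-negAt-self (suc i) w d (s≤s z≤n) le

module StaircaseOrder (n : ℕ) where
  open import Relation.Binary.Construct.Closure.Transitive using ([_]; _∷_; _∷ʳ_; _++_)

  InQ′ : ℕ → ℕ → Set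
  InQ′ r c = 1 ≤ r × 1 ≤ c × r + c ≤ suc n

  toQ′ : ∀ {r c} → InQ n (r , c) → InQ′ r c
  toQ′ {r} {c} (1≤r , r≤n , 1≤c , c≤) = 1≤r , 1≤c ,
    ≤-trans (+-monoʳ-≤ r c≤) (≤-reflexive e)
    where
    e : r + (n ∸ r + 1) ≡ suc n
    e = trans (sym (+-assoc r (n ∸ r) 1)) (trans (cong (_+ 1) (m+[n∸m]≡n r≤n)) (+-comm n 1))

  fromQ′ : ∀ {r c} → InQ′ r c → InQ n (r , c)
  fromQ′ {r} {c} (1≤r , 1≤c , le) = 1≤r , r≤n , 1≤c , c≤
    where
    r≤n : r ≤ n
    r≤n = ≤-pred (≤-trans (≤-reflexive (+-comm 1 r)) (≤-trans (+-monoʳ-≤ r 1≤c) le))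
    c≤ : c ≤ n ∸ r + 1
    c≤ = ≤-trans (≤-reflexive (sym (m+n∸m≡n r c)))
          (≤-trans (∸-monoˡ-≤ r le) (≤-reflexive (trans (cong (_∸ r) (+-comm 1 n)) (+-∸-comm 1 r≤n))))

  _<Q_ : Box → Box → Set
  x <Q y = x <Q[ n ] y

  InQ′-left : ∀ {r c} → InQ′ r (suc c) → 1 ≤ c → InQ′ r c
  InQ′-left (a , b , le) 1≤c = a , 1≤c , ≤-trans (+-monoʳ-≤ _ (n≤1+n _)) le

  InQ′-up : ∀ {r c} → InQ′ (suc r) c → 1 ≤ r → InQ′ r c
  InQ′-up (a , b , le) 1≤r = 1≤r , b , ≤-trans (n≤1+n _) le

  <Q-right : ∀ e r c → InQ′ r c → InQ′ r (suc e + c) → (r , c) <Q (r , suc e + c)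
  <Q-right zero r c q q' = [ right (fromQ′ q) (fromQ′ q') ]
  <Q-right (suc e) r c q q' = <Q-right e r c q q1 ∷ʳ right (fromQ′ q1) (fromQ′ q')
    where
    q1 : InQ′ r (suc e + c)
    q1 = InQ′-left q' (≤-trans (proj₁ (proj₂ q)) (m≤n+m c (suc e)))

  <Q-up : ∀ d r c → InQ′ (suc d + r) c → InQ′ r c → (suc d + r , c) <Q (r , c)
  <Q-up zero r c q q' = [ up (fromQ′ q) (fromQ′ q') ]
  <Q-up (suc d) r c q q' = up (fromQ′ q) (fromQ′ q1) ∷ <Q-up d r c q1 q'
    where
    q1 : InQ′ (suc d + r) c
    q1 = InQ′-up q (≤-trans (proj₁ q') (m≤n+m r (suc d)))

  ≤Q-coordinatewise : ∀ r c r' c' → InQ′ r c → InQ′ r' c' → r' ≤ r → c ≤ c' →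
    ((r , c) ≡ (r' , c')) ⊎ ((r , c) <Q (r' , c'))
  ≤Q-coordinatewise r c r' c' q q' le1 le2 = go (r ∸ r') (c' ∸ c) (m∸n+n≡m le1) (m∸n+n≡m le2)
    where
    mid : ∀ e → e + c ≡ c' → InQ′ r' c
    mid e eq = proj₁ q' , proj₁ (proj₂ q) , ≤-trans (+-monoʳ-≤ r' (≤-trans (m≤n+m c e) (≤-reflexive eq))) (proj₂ (proj₂ q'))
    go : ∀ d e → d + r' ≡ r → e + c ≡ c' → ((r , c) ≡ (r' , c')) ⊎ ((r , c) <Q (r' , c'))
    go zero zero refl refl = inj₁ refl
    go zero (suc e) refl refl = inj₂ (<Q-right e r' c q q')
    go (suc d) zero refl refl = inj₂ (<Q-up d r' c q q')
    go (suc d) (suc e) refl refl = inj₂ (<Q-up d r' c q (mid (suc e) refl) ++ <Q-right e r' c (mid (suc e) refl) q')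

-- The boxes in `mem` as a wiring diagram whose boundary position q carries β q. Box (r, c) acts on
-- positions r + c - 1 and r + c, which enter it from above and from the right; k is fuel.
module Wiring (n : ℕ) (D : Box → Entry) (mem : Box → Bool) (β : ℕ → ℕ) where

  mutual
    fromRight : ℕ → ℕ → ℕ → ℕ
    fromRight c zero r = β (r + c ∸ 1)
    fromRight c (suc k) r = if mem (r , c) then toLeft c k r else β (r + c ∸ 1)

    toLeft : ℕ → ℕ → ℕ → ℕ
    toLeft c k r = if (r + c ∸ 1) <ᵇ n
      then byEntry (D (r , c)) (fromRight (suc c) k r) (fromAbove c k r)
      else byEntry (D (r , c)) (mirror n (fromAbove c k r)) (fromAbove c k r)

    fromAbove : ℕ → ℕ → ℕ → ℕ
    fromAbove c k zero = 0
    fromAbove c k (suc r) = if mem (r , c) then byEntry (D (r , c)) (fromAbove c k r) (fromRight (suc c) k r) else β (r + c)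

  topInput : Box → ℕ
  topInput (r , c) = fromAbove c (n ∸ c) r

  rightInput : Box → ℕ
  rightInput (r , c) = fromRight (suc c) (n ∸ c) r

  Valid : Box → Set
  Valid (r , c) = if (r + c ∸ 1) <ᵇ n then topInput (r , c) < rightInput (r , c) else topInput (r , c) ≤ n

module BoxLists (n : ℕ) where
  open import Data.List using (reverse; _++_; [_])
  open import Data.List.Properties using (unfold-reverse)
  open import Data.List.Relation.Unary.All using (tabulate; lookup)
  open import Data.List.Relation.Unary.All.Properties using (All¬⇒¬Any)
  open import Data.List.Relation.Unary.Any using (here; there)
  open import Data.List.Relation.Unary.Any.Properties using (reverse⁻; ++⁻)
  open import Data.List.Relation.Unary.AllPairs using (_∷_)
  open import Data.List.Relation.Unary.Unique.Propositional using (Unique)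
  open import Data.Product.Properties using (≡-dec)
  open import Relation.Binary.Definitions using (DecidableEquality)
  open import Relation.Nullary using (does)
  open StaircaseOrder n using (_<Q_)

  _≟Box_ : DecidableEquality Box
  _≟Box_ = ≡-dec _≟_ _≟_

  open import Data.List.Membership.DecPropositional _≟Box_ using (_∈?_; _∈_; _∉_)

  mem : List Box → Box → Bool
  mem S y = does (y ∈? S)

  mem-true : ∀ S y → y ∈ S → mem S y ≡ true
  mem-true S y p with y ∈? S
  ... | yes _ = refl
  ... | no np = ⊥-elim (np p)

  mem-false : ∀ S y → y ∉ S → mem S y ≡ false
  mem-false S y np with y ∈? S
  ... | yes p = ⊥-elim (np p)
  ... | no _ = refl

  mem-true⁻ : ∀ S y → mem S y ≡ true → y ∈ S
  mem-true⁻ S y e with y ∈? S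
  ... | yes p = p
  mem-true⁻ S y () | no _

  mem-false⁻ : ∀ S y → mem S y ≡ false → y ∉ S
  mem-false⁻ S y e with y ∈? S
  mem-false⁻ S y () | yes _
  ... | no np = np

  All-⇔ : ∀ {P Q : Box → Set} {xs} → (∀ y → y ∈ xs → P y ≡ Q y) → All P xs ⇔ All Q xs
  All-⇔ eq = mk⇔ (λ a → tabulate λ {y} m → subst id (eq y m) (lookup a m))
                 (λ a → tabulate λ {y} m → subst id (sym (eq y m)) (lookup a m))

  InsideQ : List Box → Set
  InsideQ S = ∀ y → y ∈ S → InQ n y

  DownClosed : List Box → Set
  DownClosed S = ∀ x y → y ∈ S → x <Q y → x ∈ S

  DownClosed-tail : ∀ b S' → DownClosed (b ∷ S') → (∀ y → y ∈ S' → ¬ (b <Q y)) → DownClosed S'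
  DownClosed-tail b S' dc mx x y m lt with dc x y (there m) lt
  ... | here refl = ⊥-elim (mx y m lt)
  ... | there m' = m'

  MaximalFirst : List Box → Set
  MaximalFirst [] = ⊤
  MaximalFirst (b ∷ S) = b ∉ S × (∀ y → y ∈ S → ¬ (b <Q y)) × MaximalFirst S

  MaximalFirst-∷ʳ : ∀ S x → MaximalFirst S → x ∉ S → (∀ b → b ∈ S → ¬ (b <Q x)) → MaximalFirst (S ++ [ x ])
  MaximalFirst-∷ʳ [] x _ _ _ = (λ ()) , (λ _ ()) , tt
  MaximalFirst-∷ʳ (b ∷ S) x (b∉S , b-max , S-max) x∉S below-x =
    b∉ (++⁻ S) , (λ y m → b-max′ y (++⁻ S m)) , MaximalFirst-∷ʳ S x S-max (λ m → x∉S (there m)) (λ b' m → below-x b' (there m))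
    where
    b∉ : (b ∈ S ++ [ x ] → b ∈ S ⊎ b ∈ [ x ]) → b ∉ S ++ [ x ]
    b∉ split m with split m
    ... | inj₁ m′ = b∉S m′
    ... | inj₂ (here refl) = x∉S (here refl)
    b-max′ : ∀ y → y ∈ S ⊎ y ∈ [ x ] → ¬ (b <Q y)
    b-max′ y (inj₁ m) = b-max y m
    b-max′ y (inj₂ (here refl)) = below-x b (here refl)

  NoLaterBelow : List Box → Set
  NoLaterBelow [] = ⊤
  NoLaterBelow (x ∷ L) = (∀ y → y ∈ L → ¬ (y <Q x)) × NoLaterBelow L

  MaximalFirst-reverse : ∀ L → Unique L → NoLaterBelow L → MaximalFirst (reverse L)
  MaximalFirst-reverse [] _ _ = tt
  MaximalFirst-reverse (x ∷ L) (x∉L ∷ u) (x-min , L-ok) =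
    subst MaximalFirst (sym (unfold-reverse x L))
      (MaximalFirst-∷ʳ (reverse L) x (MaximalFirst-reverse L u L-ok) (λ m → All¬⇒¬Any x∉L (reverse⁻ m)) (λ b m → x-min b (reverse⁻ m)))

  All⇔∀mem : ∀ {P : Box → Set} S → All P S ⇔ (∀ y → mem S y ≡ true → P y)
  All⇔∀mem S = mk⇔ (λ a y e → lookup a (mem-true⁻ S y e)) (λ f → tabulate λ {y} m → f y (mem-true S y m))

module Processing (n : ℕ) (D : Box → Entry) where
  open import Data.List.Relation.Unary.Any using (here; there)
  open SignedPermutation n
  open StaircaseOrder n
  open BoxLists n
  open import Data.List.Membership.DecPropositional _≟Box_ using (_∈?_; _∈_; _∉_)

  Moved : ℕ → ℕ → Set
  Moved p q = q ≡ p ⊎ ((p <ᵇ n) ≡ true × q ≡ suc p)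

  -- β′ lists the ranks of the entries of v s_p (entry 0) or of v (entry +), where β lists those of v.
  record StepsTo (p : ℕ) (e : Entry) (β β′ : ℕ → ℕ) : Set where
    field
      unmoved : ∀ q → ¬ Moved p q → β′ q ≡ β q
      atLabel : β′ p ≡ (if p <ᵇ n then byEntry e (β (suc p)) (β p) else byEntry e (mirror n (β p)) (β p))
      atNext : (p <ᵇ n) ≡ true → β′ (suc p) ≡ byEntry e (β p) (β (suc p))

  plus-stepsTo : ∀ p β → StepsTo p pls β β
  plus-stepsTo p β = record { unmoved = λ _ _ → refl ; atLabel = atLabel ; atNext = λ _ → refl }
    where
    atLabel : β p ≡ (if p <ᵇ n then β p else β p)
    atLabel with p <ᵇ n
    ... | true = refl
    ... | false = refl

  zero-stepsTo : ∀ w p → IsSignedPerm w → 1 ≤ p → p ≤ n → StepsTo p zer (ranks w) (ranks (mulGen n w p))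
  zero-stepsTo w p sp 1≤p p≤n = record { unmoved = unmoved ; atLabel = atLabel ; atNext = atNext }
    where
    len = proj₁ sp

    unmoved : ∀ q → ¬ Moved p q → ranks (mulGen n w p) q ≡ ranks w q
    unmoved q nc with p <ᵇ n in e
    ... | true = cong rank (entryOr-swapAt-other p w q (+ q) (λ eq → nc (inj₁ eq)) (λ eq → nc (inj₂ (refl , eq))))
    ... | false = cong rank (entryOr-negAt-other n w q (+ q) (λ eq → nc (inj₁ (trans eq (sym (<ᵇ-false p p≤n e))))))

    atLabel : ranks (mulGen n w p) p ≡ (if p <ᵇ n then ranks w (suc p) else mirror n (ranks w p))
    atLabel with p <ᵇ n in e
    ... | true = cong rank (entryOr-swapAt-left p w (+ p) (+ suc p) 1≤p (subst (suc p ≤_) (sym len) (<ᵇ-true p e)))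
    ... | false = subst (λ t → rank (entryOr (negAt n w) t (+ t)) ≡ mirror n (rank (entryOr w t (+ t)))) (sym pn)
                    (trans (cong rank (entryOr-negAt-self n w (+ n) 1≤n (≤-reflexive (sym len))))
                      (rank-neg (entry w n) (All-entryOr w n (+ n) (proj₁ (proj₂ sp)) 1≤n (≤-reflexive (sym len)))))
      where
      pn : p ≡ n
      pn = <ᵇ-false p p≤n e
      1≤n : 1 ≤ n
      1≤n = subst (1 ≤_) pn 1≤p

    atNext : (p <ᵇ n) ≡ true → ranks (mulGen n w p) (suc p) ≡ ranks w p
    atNext e rewrite e = cong rank (entryOr-swapAt-right p w (+ suc p) (+ p) 1≤p (subst (suc p ≤_) (sym len) (<ᵇ-true p e)))

  -- Adding a maximal box b to S′ only changes the values on the wires leaving b, and these are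
  -- exactly the values that β′ feeds into the boundary of S′ at the positions s_p moves.
  module HeadBox (S' : List Box) (r1 c0 : ℕ) (β β' : ℕ → ℕ)
    (inQ : InsideQ ((suc r1 , c0) ∷ S')) (down : DownClosed ((suc r1 , c0) ∷ S'))
    (head∉ : (suc r1 , c0) ∉ S') (head-max : ∀ y → y ∈ S' → ¬ ((suc r1 , c0) <Q y))
    (st : StepsTo (r1 + c0) (D (suc r1 , c0)) β β')
    where
    open StepsTo st

    b : Box
    b = (suc r1 , c0)
    p : ℕ
    p = r1 + c0
    S : List Box
    S = b ∷ S'

    open Wiring n D (mem S) β using () renaming (fromRight to fromRight₁; fromAbove to fromAbove₁; toLeft to toLeft₁)
    open Wiring n D (mem S') β' using () renaming (fromRight to fromRight₂; fromAbove to fromAbove₂; toLeft to toLeft₂)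

    head-inQ′ : InQ′ (suc r1) c0
    head-inQ′ = toQ′ (inQ b (here refl))

    p≤n : p ≤ n
    p≤n = ≤-pred (proj₂ (proj₂ head-inQ′))

    inQ′ : ∀ y → y ∈ S' → InQ′ (proj₁ y) (proj₂ y)
    inQ′ y m = toQ′ (inQ y (there m))

    ≤head⇒∈ : ∀ r c → InQ′ r c → suc r1 ≤ r → c ≤ c0 → (r , c) ∈ S
    ≤head⇒∈ r c q le1 le2 with ≤Q-coordinatewise r c (suc r1) c0 q head-inQ′ le1 le2
    ... | inj₁ eq = here eq
    ... | inj₂ lt = down (r , c) b (here refl) lt

    rest≱head : ∀ r c → (r , c) ∈ S' → r ≤ suc r1 → c0 ≤ c → ⊥
    rest≱head r c m le1 le2 with ≤Q-coordinatewise (suc r1) c0 r c head-inQ′ (inQ′ _ m) le1 le2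
    ... | inj₁ eq = head∉ (subst (_∈ S') (sym eq) m)
    ... | inj₂ lt = head-max (r , c) m lt

    mem-head : mem S b ≡ true
    mem-head = mem-true S b (here refl)

    mem-rest-head : mem S' b ≡ false
    mem-rest-head = mem-false S' b head∉

    mem-other : ∀ y → y ≢ b → mem S y ≡ mem S' y
    mem-other y ne = caseRest (y ∈? S')
      where
      caseRest : Dec (y ∈ S') → mem S y ≡ mem S' y
      caseRest (yes m) = trans (mem-true S y (there m)) (sym (mem-true S' y m))
      caseRest (no nm) = trans (mem-false S y λ { (here e) → ne e ; (there m) → nm m }) (sym (mem-false S' y nm))

    Moved-bounds : ∀ q → Moved p q → p ≤ q × q ≤ suc p × q ≤ n
    Moved-bounds q (inj₁ refl) = ≤-refl , n≤1+n p , p≤n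
    Moved-bounds q (inj₂ (lt , refl)) = n≤1+n p , ≤-refl , <ᵇ⇒< p n (subst T (sym lt) tt)

    unmoved-fromAbove : ∀ r' c → (suc r' , c) ∈ S' → (r' , c) ∉ S → ¬ Moved p (r' + c)
    unmoved-fromAbove r' c m nm ch with Moved-bounds _ ch | r' ≤? r1
    ... | lo , hi , _ | yes r'≤r1 = rest≱head (suc r') c m (s≤s r'≤r1) (≤-of-+ r1 c0 r' c lo r'≤r1)
    ... | lo , hi , _ | no r'≰r1 = nm (≤head⇒∈ r' c (≤-trans (s≤s z≤n) (≰⇒> r'≰r1) , proj₁ (proj₂ qy) , ≤-trans (n≤1+n _) (proj₂ (proj₂ qy)))
                           (≰⇒> r'≰r1) (≤-of-+ r' c (suc r1) c0 hi (≰⇒> r'≰r1)))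
      where
      qy = inQ′ _ m

    unmoved-fromRight : ∀ r c → (r , c) ∈ S' → (r , suc c) ∉ S → ¬ Moved p (r + c)
    unmoved-fromRight r c m nm ch with Moved-bounds _ ch | c0 ≤? c
    ... | lo , hi , _ | yes c0≤c = rest≱head r c m (+-cancelʳ-≤ c0 r (suc r1) (≤-trans (+-monoʳ-≤ r c0≤c) hi)) c0≤c
    ... | lo , hi , q≤n | no c0≰c =
      nm (≤head⇒∈ r (suc c) (≤-trans (s≤s z≤n) r≥ , s≤s z≤n , ≤-trans (≤-reflexive (+-suc r c)) (s≤s q≤n)) r≥ (≰⇒> c0≰c))
      where
      r≥ : suc r1 ≤ r
      r≥ = +-cancelʳ-≤ c (suc r1) r (≤-trans (≤-reflexive (sym (+-suc r1 c))) (≤-trans (+-monoʳ-≤ r1 (≰⇒> c0≰c)) lo))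

    above-head∉ : (r1 , c0) ∉ S
    above-head∉ (here e) = 1+n≢n (sym (cong proj₁ e))
    above-head∉ (there m) = rest≱head r1 c0 m (n≤1+n r1) ≤-refl

    right-head∉ : (suc r1 , suc c0) ∉ S
    right-head∉ (here e) = 1+n≢n (cong proj₂ e)
    right-head∉ (there m) = rest≱head (suc r1) (suc c0) m ≤-refl (n≤1+n c0)

    fromAbove-head : ∀ k → fromAbove₁ c0 k (suc r1) ≡ β p
    fromAbove-head k rewrite mem-false S (r1 , c0) above-head∉ = refl

    fromRight-head : ∀ k → fromRight₁ (suc c0) k (suc r1) ≡ β (suc p)
    fromRight-head zero = cong β (+-suc r1 c0)
    fromRight-head (suc k) rewrite mem-false S (suc r1 , suc c0) right-head∉ = cong β (+-suc r1 c0)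

    toLeft-head : ∀ k → toLeft₁ c0 k (suc r1) ≡ β' p
    toLeft-head k rewrite fromAbove-head k | fromRight-head k = sym atLabel

    fromRight-at-head : ∀ k → fromRight₁ c0 (suc k) (suc r1) ≡ fromRight₂ c0 (suc k) (suc r1)
    fromRight-at-head k rewrite mem-head | mem-rest-head = toLeft-head k

    toLeft-cong : ∀ c k r → fromRight₁ (suc c) k r ≡ fromRight₂ (suc c) k r → fromAbove₁ c k r ≡ fromAbove₂ c k r →
      toLeft₁ c k r ≡ toLeft₂ c k r
    toLeft-cong c k r e1 e2 rewrite e1 | e2 = refl

    fromAbove-below-head : ∀ k → (suc (suc r1) , c0) ∈ S' → fromAbove₁ c0 k (suc (suc r1)) ≡ fromAbove₂ c0 k (suc (suc r1))
    fromAbove-below-head k mb rewrite mem-head | mem-rest-head | fromAbove-head k | fromRight-head k = sym (atNext (Equivalence.to T-≡ (<⇒<ᵇ p<n)))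
      where
      p<n : p < n
      p<n = ≤-pred (proj₂ (proj₂ (inQ′ _ mb)))

    mutual
      fromRight-agree : ∀ k c r → n ≤ c + k → (r , c) ∈ S' → fromRight₁ (suc c) k r ≡ fromRight₂ (suc c) k r
      fromRight-agree zero c r le m = sym (unmoved _ (subst (λ z → ¬ Moved p z) (sym (+-suc-∸1 r c (proj₁ (inQ′ _ m)))) (unmoved-fromRight r c m ni)))
        where
        ni : (r , suc c) ∉ S
        ni m2 = 1+n≰n (≤-pred (≤-trans (≤-trans (s≤s (s≤s (≤-trans le (≤-reflexive (+-identityʳ c))))) (+-monoˡ-≤ (suc c) (proj₁ (inQ′ _ m)))) (proj₂ (proj₂ (toQ′ (inQ _ m2))))))
      fromRight-agree (suc k) c r le m = caseHead ((r , suc c) ≟Box b)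
        where
        le' : n ≤ suc c + k
        le' = ≤-trans le (≤-reflexive (+-suc c k))
        caseHead : Dec ((r , suc c) ≡ b) → fromRight₁ (suc c) (suc k) r ≡ fromRight₂ (suc c) (suc k) r
        caseHead (yes eq) = subst (λ y → fromRight₁ (proj₂ y) (suc k) (proj₁ y) ≡ fromRight₂ (proj₂ y) (suc k) (proj₁ y)) (sym eq) (fromRight-at-head k)
        caseHead (no ne) = if-cong (mem S (r , suc c)) (mem S' (r , suc c)) (mem-other _ ne)
          (λ e → toLeft-cong (suc c) k r (fromRight-agree k (suc c) r le' (mem-true⁻ S' _ e)) (fromAbove-agree k (suc c) r le' (mem-true⁻ S' _ e)))
          (λ e → sym (unmoved _ (subst (λ z → ¬ Moved p z) (sym (+-suc-∸1 r c (proj₁ (inQ′ _ m))))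
                   (unmoved-fromRight r c m (mem-false⁻ S _ (trans (mem-other _ ne) e))))))

      fromAbove-agree : ∀ k c r → n ≤ c + k → (r , c) ∈ S' → fromAbove₁ c k r ≡ fromAbove₂ c k r
      fromAbove-agree k c zero le m = refl
      fromAbove-agree k c (suc r) le m = caseHead ((r , c) ≟Box b)
        where
        caseHead : Dec ((r , c) ≡ b) → fromAbove₁ c k (suc r) ≡ fromAbove₂ c k (suc r)
        caseHead (yes eq) = subst (λ y → fromAbove₁ (proj₂ y) k (suc (proj₁ y)) ≡ fromAbove₂ (proj₂ y) k (suc (proj₁ y))) (sym eq)
                         (fromAbove-below-head k (subst (λ y → (suc (proj₁ y) , proj₂ y) ∈ S') eq m))
        caseHead (no ne) = if-cong (mem S (r , c)) (mem S' (r , c)) (mem-other _ ne)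
          (λ e → cong₂ (byEntry (D (r , c))) (fromAbove-agree k c r le (mem-true⁻ S' _ e)) (fromRight-agree k c r le (mem-true⁻ S' _ e)))
          (λ e → sym (unmoved _ (unmoved-fromAbove r c m (mem-false⁻ S _ (trans (mem-other _ ne) e)))))

    open Wiring n D (mem S) β using () renaming (Valid to Valid₁) public
    open Wiring n D (mem S') β' using () renaming (Valid to Valid₂)

    Valid-agree : ∀ y → y ∈ S' → Valid₁ y ≡ Valid₂ y
    Valid-agree (r , c) m rewrite fromAbove-agree (n ∸ c) c r (m≤n+m∸n n c) m | fromRight-agree (n ∸ c) c r (m≤n+m∸n n c) m = refl

    Valid-head : Valid₁ b ≡ (if p <ᵇ n then β p < β (suc p) else β p ≤ n)
    Valid-head rewrite fromAbove-head (n ∸ c0) | fromRight-head (n ∸ c0) = refl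

  module Step (S' : List Box) (r1 c0 : ℕ) (w w' : List ℤ) (sp : IsSignedPerm w)
    (inQ : InsideQ ((suc r1 , c0) ∷ S')) (down : DownClosed ((suc r1 , c0) ∷ S'))
    (head∉ : (suc r1 , c0) ∉ S') (head-max : ∀ y → y ∈ S' → ¬ ((suc r1 , c0) <Q y))
    (st : StepsTo (r1 + c0) (D (suc r1 , c0)) (ranks w) (ranks w'))
    (ih : GammaSteps n D w' S' ⇔ All (Wiring.Valid n D (mem S') (ranks w')) S')
    where

    open HeadBox S' r1 c0 (ranks w) (ranks w') inQ down head∉ head-max st

    1≤p : 1 ≤ p
    1≤p = ≤-trans (proj₁ (proj₂ head-inQ′)) (m≤n+m c0 r1)

    ascent⇔comparison : Ascent w p ⇔ (if p <ᵇ n then ranks w p < ranks w (suc p) else ranks w p ≤ n)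
    ascent⇔comparison with p <ᵇ n in e
    ... | true = mk⇔ id id
    ... | false = mk⇔ (subst (λ t → rank (entry w t) ≤ n) (sym pn)) (subst (λ t → rank (entry w t) ≤ n) pn)
      where
      pn : p ≡ n
      pn = <ᵇ-false p p≤n e

    head⇔ : (w <B[ n ] mulGen n w p) ⇔ Valid₁ b
    head⇔ = ⇔-trans (bruhatCover⇔ascent w p sp 1≤p p≤n) (⇔-trans ascent⇔comparison (≡⇒⇔ (sym Valid-head)))

    step : ((w <B[ n ] mulGen n w p) × GammaSteps n D w' S') ⇔ All Valid₁ (b ∷ S')
    step = ⇔-trans (head⇔ ×-⇔ ⇔-trans ih (⇔-sym (All-⇔ Valid-agree))) ×⇔All-∷

  gammaSteps⇔allValid : ∀ S w → InsideQ S → DownClosed S → MaximalFirst S → IsSignedPerm w →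
    GammaSteps n D w S ⇔ All (Wiring.Valid n D (mem S) (ranks w)) S
  gammaSteps⇔allValid [] w _ _ _ _ = mk⇔ (λ _ → []) (λ _ → tt)
  gammaSteps⇔allValid ((zero , c0) ∷ S') w inQ _ _ _ with proj₁ (inQ _ (here refl))
  ... | ()
  gammaSteps⇔allValid ((suc r1 , c0) ∷ S') w inQ down (head∉ , head-max , pr) sp with D (suc r1 , c0) in eD
  ... | pls = Step.step S' r1 c0 w w sp inQ down head∉ head-max
                (subst (λ e → StepsTo (r1 + c0) e (ranks w) (ranks w)) (sym eD) (plus-stepsTo (r1 + c0) (ranks w)))
                (gammaSteps⇔allValid S' w (λ y m → inQ y (there m)) (DownClosed-tail _ S' down head-max) pr sp)
  ... | zer = Step.step S' r1 c0 w (mulGen n w (r1 + c0)) sp inQ down head∉ head-max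
                (subst (λ e → StepsTo (r1 + c0) e (ranks w) (ranks (mulGen n w (r1 + c0)))) (sym eD)
                  (zero-stepsTo w (r1 + c0) sp (≤-trans (proj₁ (proj₂ head-inQ′)) (m≤n+m c0 r1)) (≤-pred (proj₂ (proj₂ head-inQ′)))))
                (gammaSteps⇔allValid S' (mulGen n w (r1 + c0)) (λ y m → inQ y (there m)) (DownClosed-tail _ S' down head-max) pr
                  (IsSignedPerm-mulGen w (r1 + c0) sp))
    where
    head-inQ′ = toQ′ (inQ _ (here refl))

module Columns (n : ℕ) (D : Box → Entry) (m : Box → Bool) (β : ℕ → ℕ)
  (β≡id : ∀ q → β q ≡ q)
  (mem-inQ : ∀ r c → m (r , c) ≡ true → InQ n (r , c))
  (mem-downward : ∀ r c r' c' → m (r , c) ≡ true → InQ n (r' , c') → r ≤ r' → c' ≤ c → m (r' , c') ≡ true)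
  where
  open Wiring n D m β
  open StaircaseOrder n using (InQ′; toQ′; fromQ′)

  mem⇒InQ′ : ∀ r c → m (r , c) ≡ true → InQ′ r c
  mem⇒InQ′ r c e = toQ′ (mem-inQ r c e)

  rightOf : ℕ → ℕ → ℕ
  rightOf c r = fromRight (suc c) (n ∸ c) r

  Blocked : ℕ → ℕ → Set
  Blocked c r = Σ ℕ λ C → c < C × m (r , C) ≡ true × D (r , C) ≡ zer ×
    ((Σ ℕ λ r' → r < r' × m (r' , C) ≡ true × D (r' , C) ≡ pls) ⊎ IsDiagonal n (r , C))

  Good : ℕ → ℕ → Set
  Good c r = rightOf c r ≤ n × (∀ r' → r < r' → r' + c ≤ n → rightOf c r < rightOf c r')

  GoodIff¬BlockedAt : ℕ → ℕ → Set
  GoodIff¬BlockedAt c r = (¬ Blocked c r → Good c r) × (Good c r → ¬ Blocked c r)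

  GoodIff¬Blocked : ℕ → Set
  GoodIff¬Blocked c = ∀ r → 1 ≤ r → r + c ≤ n → GoodIff¬BlockedAt c r

  good⇒iff : ∀ {c r} → Good c r → ¬ Blocked c r → GoodIff¬BlockedAt c r
  good⇒iff g nb = (λ _ → g) , (λ _ → nb)

  blocked⇒iff : ∀ {c r} → Blocked c r → ¬ Good c r → GoodIff¬BlockedAt c r
  blocked⇒iff b ng = (λ nb → ⊥-elim (nb b)) , (λ g → ⊥-elim (ng g))

  RightOfBounded : ℕ → Set
  RightOfBounded c = ∀ t r → (∀ x → m (x , suc c) ≡ true → t ≤ x) → t ≤ r → r + c ≤ n → 1 ≤ r → t + c ≤ rightOf c r

  ColumnCondition : ℕ → Set
  ColumnCondition c = ∀ r → m (r , c) ≡ true → Blocked c r → D (r , c) ≡ zer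

  ColumnValid : ℕ → Set
  ColumnValid c = ∀ r → m (r , c) ≡ true → Valid (r , c)

  module Column (c : ℕ) (c<n : c < n) where
    fuel : ℕ
    fuel = n ∸ suc c

    Rin : ℕ → ℕ
    Rin r = rightOf (suc c) r

    Tin : ℕ → ℕ
    Tin r = fromAbove (suc c) fuel r

    n∸c : n ∸ c ≡ suc fuel
    n∸c = +-∸-assoc 1 c<n

    Tin-outside : ∀ r → m (r , suc c) ≡ false → Tin (suc r) ≡ r + suc c
    Tin-outside r e rewrite e = β≡id _

    Tin-inside : ∀ r → m (r , suc c) ≡ true → Tin (suc r) ≡ byEntry (D (r , suc c)) (Tin r) (Rin r)
    Tin-inside r e rewrite e = refl

    rightOf-unfold : ∀ r → rightOf c r ≡ (if m (r , suc c) then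
                  (if (r + suc c ∸ 1) <ᵇ n then byEntry (D (r , suc c)) (Rin r) (Tin r) else byEntry (D (r , suc c)) (mirror n (Tin r)) (Tin r))
                else β (r + suc c ∸ 1))
    rightOf-unfold r rewrite n∸c = refl

    rightOf-outside : ∀ r → 1 ≤ r → m (r , suc c) ≡ false → rightOf c r ≡ r + c
    rightOf-outside r 1≤r e rewrite rightOf-unfold r | e = trans (β≡id _) (+-suc-∸1 r c 1≤r)

    label<ᵇn : ∀ r → 1 ≤ r → r + c < n → ((r + suc c ∸ 1) <ᵇ n) ≡ true
    label<ᵇn r 1≤r lt rewrite +-suc-∸1 r c 1≤r = Equivalence.to T-≡ (<⇒<ᵇ lt)

    label≮ᵇn : ∀ r → 1 ≤ r → r + c ≡ n → ((r + suc c ∸ 1) <ᵇ n) ≡ false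
    label≮ᵇn r 1≤r eq rewrite +-suc-∸1 r c 1≤r | eq = <ᵇ-irrefl n

    rightOf-offDiagonal : ∀ r → 1 ≤ r → r + c < n → m (r , suc c) ≡ true → rightOf c r ≡ byEntry (D (r , suc c)) (Rin r) (Tin r)
    rightOf-offDiagonal r 1≤r lt e rewrite rightOf-unfold r | e | label<ᵇn r 1≤r lt = refl

    rightOf-diagonal : ∀ r → 1 ≤ r → r + c ≡ n → m (r , suc c) ≡ true → rightOf c r ≡ byEntry (D (r , suc c)) (mirror n (Tin r)) (Tin r)
    rightOf-diagonal r 1≤r eq e rewrite rightOf-unfold r | e | label≮ᵇn r 1≤r eq = refl

    Valid-offDiagonal : ∀ r → 1 ≤ r → r + c < n → Valid (r , suc c) ≡ (Tin r < Rin r)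
    Valid-offDiagonal r 1≤r lt rewrite label<ᵇn r 1≤r lt = refl

    Valid-diagonal : ∀ r → 1 ≤ r → r + c ≡ n → Valid (r , suc c) ≡ (Tin r ≤ n)
    Valid-diagonal r 1≤r eq rewrite label≮ᵇn r 1≤r eq = refl

    rowBounds : ∀ r → m (r , suc c) ≡ true → 1 ≤ r × r + c ≤ n
    rowBounds r e with mem⇒InQ′ r (suc c) e
    ... | a , _ , le = a , ≤-pred (≤-trans (≤-reflexive (sym (+-suc r c))) le)

    mem-down : ∀ r r' → m (r , suc c) ≡ true → r ≤ r' → r' + c ≤ n → m (r' , suc c) ≡ true
    mem-down r r' e le le' = mem-downward r (suc c) r' (suc c) e
      (fromQ′ (≤-trans (proj₁ (rowBounds r e)) le , s≤s z≤n , ≤-trans (≤-reflexive (+-suc r' c)) (s≤s le'))) le ≤-refl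

    mem-left : ∀ r C → m (r , C) ≡ true → suc c ≤ C → m (r , suc c) ≡ true
    mem-left r C e le with mem⇒InQ′ r C e
    ... | a , b , le2 = mem-downward r C r (suc c) e (fromQ′ (a , s≤s z≤n , ≤-trans (+-monoʳ-≤ r le) le2)) ≤-refl le

    TopGood : ℕ → Set
    TopGood r = Tin r ≤ n × (∀ r'' → r ≤ r'' → r'' + suc c ≤ n → Tin r < Rin r'')

    Tin-zero : ∀ r → m (r , suc c) ≡ true → D (r , suc c) ≡ zer → Tin (suc r) ≡ Tin r
    Tin-zero r e eD = trans (Tin-inside r e) (cong (λ z → byEntry z (Tin r) (Rin r)) eD)

    Tin-plus : ∀ r → m (r , suc c) ≡ true → D (r , suc c) ≡ pls → Tin (suc r) ≡ Rin r
    Tin-plus r e eD = trans (Tin-inside r e) (cong (λ z → byEntry z (Tin r) (Rin r)) eD)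

    module FromRight (goodIff : GoodIff¬Blocked (suc c)) (bounded : RightOfBounded (suc c)) where

      rowLowerBound : ∀ r → m (r , suc c) ≡ false → suc r + c ≤ n → ∀ x → m (x , suc (suc c)) ≡ true → suc r ≤ x
      rowLowerBound r e le x ex with x ≤? r
      ... | no nle = ≰⇒> nle
      ... | yes x≤r = ⊥-elim (true≢false (trans (sym (mem-downward x (suc (suc c)) r (suc c) ex
              (fromQ′ (≤-trans (proj₁ (mem⇒InQ′ x _ ex)) x≤r , s≤s z≤n , ≤-trans (≤-reflexive (+-suc r c)) (s≤s (≤-trans (n≤1+n _) le)))) x≤r (n≤1+n _))) e))

      TopGood-fromCondition : ColumnCondition (suc c) → ∀ r → m (r , suc c) ≡ true → TopGood r
      TopGood-fromCondition cc zero e with proj₁ (rowBounds zero e)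
      ... | ()
      TopGood-fromCondition cc (suc r) e = caseMem (m (r , suc c)) refl
        where
        caseMem : ∀ bb → m (r , suc c) ≡ bb → TopGood (suc r)
        caseMem false e' = subst (_≤ n) (sym (Tin-outside r e')) (≤-trans (≤-reflexive (+-suc r c)) (proj₂ (rowBounds (suc r) e))) ,
                    λ r'' le le' → subst (_< Rin r'') (sym (Tin-outside r e'))
                      (bounded (suc r) r'' (rowLowerBound r e' (proj₂ (rowBounds (suc r) e))) le le' (≤-trans (s≤s z≤n) le))
        caseMem true e' = caseEntry (D (r , suc c)) refl
          where
          g = TopGood-fromCondition cc r e'
          caseEntry : ∀ dd → D (r , suc c) ≡ dd → TopGood (suc r)
          caseEntry zer eD = subst (_≤ n) (sym tz) (proj₁ g) , λ r'' le le' → subst (_< Rin r'') (sym tz) (proj₂ g r'' (≤-trans (n≤1+n r) le) le')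
            where tz = Tin-zero r e' eD
          caseEntry pls eD = subst (_≤ n) (sym tp) (proj₁ gd) , λ r'' le le' → subst (_< Rin r'') (sym tp) (proj₂ gd r'' le le')
            where
            tp = Tin-plus r e' eD
            gd : Good (suc c) r
            gd = proj₁ (goodIff r (proj₁ (rowBounds r e')) (≤-trans (≤-reflexive (+-suc r c)) (proj₂ (rowBounds (suc r) e))))
                   λ bl → zer≢pls (trans (sym (cc r e' bl)) eD)

      TopGood-step : ∀ r → m (r , suc c) ≡ true → Tin r < Rin r → TopGood (suc r) → TopGood r
      TopGood-step r e val below = caseEntry (D (r , suc c)) refl
        where
        caseEntry : ∀ dd → D (r , suc c) ≡ dd → TopGood r
        caseEntry zer eD = subst (_≤ n) tz (proj₁ below) , λ r'' le le' → atOrBelow r'' (≤⇒≡⊎< le) le'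
          where
          tz = Tin-zero r e eD
          atOrBelow : ∀ r'' → r ≡ r'' ⊎ r < r'' → r'' + suc c ≤ n → Tin r < Rin r''
          atOrBelow r'' (inj₁ refl) _ = val
          atOrBelow r'' (inj₂ lt) le' = subst (_< Rin r'') tz (proj₂ below r'' lt le')
        caseEntry pls eD = ≤-trans (<⇒≤ val) (subst (_≤ n) tp (proj₁ below)) , λ r'' le le' → atOrBelow r'' (≤⇒≡⊎< le) le'
          where
          tp = Tin-plus r e eD
          atOrBelow : ∀ r'' → r ≡ r'' ⊎ r < r'' → r'' + suc c ≤ n → Tin r < Rin r''
          atOrBelow r'' (inj₁ refl) _ = val
          atOrBelow r'' (inj₂ lt) le' = <-trans val (subst (_< Rin r'') tp (proj₂ below r'' lt le'))

      TopGood-fromValid : ColumnValid (suc c) → ∀ d r → d + (r + c) ≡ n → m (r , suc c) ≡ true → TopGood r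
      TopGood-fromValid cv zero r eq e = subst id (Valid-diagonal r (proj₁ (rowBounds r e)) eq) (cv r e) ,
        λ r'' le le' → ⊥-elim (1+n≰n (≤-trans (≤-trans (≤-reflexive (sym (trans (+-suc r c) (cong suc eq)))) (+-monoˡ-≤ (suc c) le)) le'))
      TopGood-fromValid cv (suc d) r eq e =
        TopGood-step r e (subst id (Valid-offDiagonal r (proj₁ (rowBounds r e)) lt) (cv r e))
          (TopGood-fromValid cv d (suc r) (trans (+-suc d (r + c)) eq) (mem-down r (suc r) e (n≤1+n r) lt))
        where
        lt : r + c < n
        lt = ≤-trans (s≤s (m≤n+m (r + c) d)) (≤-reflexive eq)

      TopGood-all : ColumnValid (suc c) → ∀ r → m (r , suc c) ≡ true → TopGood r
      TopGood-all cv r e = TopGood-fromValid cv (n ∸ (r + c)) r (m∸n+n≡m (proj₂ (rowBounds r e))) e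

      Good-plus : ColumnValid (suc c) → ∀ r → m (r , suc c) ≡ true → r + c < n → D (r , suc c) ≡ pls → Good (suc c) r
      Good-plus cv r e lt eD = subst (_≤ n) tp (proj₁ gs) , λ r' le le' → subst (_< Rin r') tp (proj₂ gs r' le le')
        where
        gs = TopGood-all cv (suc r) (mem-down r (suc r) e (n≤1+n r) lt)
        tp = Tin-plus r e eD

      blocked⇒offDiagonal : ∀ r → Blocked (suc c) r → r + c < n
      blocked⇒offDiagonal r (C , lt , eC , _) with mem⇒InQ′ r C eC
      ... | _ , _ , le = ≤-pred (≤-trans (≤-reflexive (cong suc (sym (+-suc r c)))) (≤-trans (≤-reflexive (sym (+-suc r (suc c)))) (≤-trans (+-monoʳ-≤ r lt) le)))

      ColumnValid⇔ColumnCondition : ColumnValid (suc c) ⇔ ColumnCondition (suc c)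
      ColumnValid⇔ColumnCondition = mk⇔ to fr
        where
        to : ColumnValid (suc c) → ColumnCondition (suc c)
        to cv r e bl with D (r , suc c) in eD
        ... | zer = refl
        ... | pls = ⊥-elim (proj₂ (goodIff r (proj₁ (rowBounds r e)) (≤-trans (≤-reflexive (+-suc r c)) (blocked⇒offDiagonal r bl)))
                         (Good-plus cv r e (blocked⇒offDiagonal r bl) eD) bl)
        fr : ColumnCondition (suc c) → ColumnValid (suc c)
        fr cc r e with TopGood-fromCondition cc r e | ≤⇒≡⊎< (proj₂ (rowBounds r e))
        ... | g | inj₁ eq = subst id (sym (Valid-diagonal r (proj₁ (rowBounds r e)) eq)) (proj₁ g)
        ... | g | inj₂ lt = subst id (sym (Valid-offDiagonal r (proj₁ (rowBounds r e)) lt)) (proj₂ g r ≤-refl (≤-trans (≤-reflexive (+-suc r c)) lt))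

      rightOf-plus : ∀ r → m (r , suc c) ≡ true → D (r , suc c) ≡ pls → rightOf c r ≡ Tin r
      rightOf-plus r e eD with ≤⇒≡⊎< (proj₂ (rowBounds r e))
      ... | inj₁ eq = trans (rightOf-diagonal r (proj₁ (rowBounds r e)) eq e) (cong (λ z → byEntry z (mirror n (Tin r)) (Tin r)) eD)
      ... | inj₂ lt = trans (rightOf-offDiagonal r (proj₁ (rowBounds r e)) lt e) (cong (λ z → byEntry z (Rin r) (Tin r)) eD)

      rightOf-zero : ∀ r → m (r , suc c) ≡ true → r + c < n → D (r , suc c) ≡ zer → rightOf c r ≡ Rin r
      rightOf-zero r e lt eD = trans (rightOf-offDiagonal r (proj₁ (rowBounds r e)) lt e) (cong (λ z → byEntry z (Rin r) (Tin r)) eD)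

      rightOf-zeroDiagonal : ∀ r → m (r , suc c) ≡ true → r + c ≡ n → D (r , suc c) ≡ zer → rightOf c r ≡ mirror n (Tin r)
      rightOf-zeroDiagonal r e eq eD = trans (rightOf-diagonal r (proj₁ (rowBounds r e)) eq e) (cong (λ z → byEntry z (mirror n (Tin r)) (Tin r)) eD)

      TinSource : ℕ → ℕ → Set
      TinSource r d = Tin (r + d) ≡ Tin r ⊎ Σ ℕ (λ r'' → r ≤ r'' × r'' < r + d × Tin (r + d) ≡ Rin r'')

      TinSource-step : ∀ r d → m (r + d , suc c) ≡ true → TinSource r d → TinSource r (suc d)
      TinSource-step r d e src = caseEntry (D (r + d , suc c)) refl src
        where
        sx = +-suc r d
        caseEntry : ∀ dd → D (r + d , suc c) ≡ dd → TinSource r d → TinSource r (suc d)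
        caseEntry zer eD (inj₁ q) = inj₁ (trans (cong Tin sx) (trans (Tin-zero (r + d) e eD) q))
        caseEntry zer eD (inj₂ (r'' , a , b , q)) =
          inj₂ (r'' , a , ≤-trans b (≤-trans (n≤1+n _) (≤-reflexive (sym sx))) , trans (cong Tin sx) (trans (Tin-zero (r + d) e eD) q))
        caseEntry pls eD _ = inj₂ (r + d , m≤m+n r d , ≤-reflexive (sym sx) , trans (cong Tin sx) (Tin-plus (r + d) e eD))

      Tin-source : ∀ d r → m (r , suc c) ≡ true → (r + d) + c ≤ n → TinSource r d
      Tin-source zero r e le = inj₁ (cong Tin (+-identityʳ r))
      Tin-source (suc d) r e le = TinSource-step r d (mem-down r (r + d) e (m≤m+n r d) le′) (Tin-source d r e le′)
        where
        le′ : (r + d) + c ≤ n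
        le′ = ≤-trans (+-monoˡ-≤ c (+-monoʳ-≤ r (n≤1+n d))) le

      Tin-increasing : ColumnValid (suc c) → ∀ r → m (r , suc c) ≡ true → D (r , suc c) ≡ pls →
        ∀ r' → r < r' → r' + c ≤ n → Tin r < Tin r'
      Tin-increasing cv r e eD r' lt le = subst (λ z → Tin r < Tin z) (m+[n∸m]≡n lt) (fromSource (Tin-source d (suc r) m1 le1))
        where
        g = TopGood-all cv r e
        d = r' ∸ suc r
        le1 : (suc r + d) + c ≤ n
        le1 = subst (λ z → z + c ≤ n) (sym (m+[n∸m]≡n lt)) le
        sr : suc r + c ≤ n
        sr = ≤-trans (+-monoˡ-≤ c lt) le
        m1 : m (suc r , suc c) ≡ true
        m1 = mem-down r (suc r) e (n≤1+n r) sr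
        fromSource : TinSource (suc r) d → Tin r < Tin (suc r + d)
        fromSource (inj₁ q) = subst (Tin r <_) (sym (trans q (Tin-plus r e eD))) (proj₂ g r ≤-refl (≤-trans (≤-reflexive (+-suc r c)) sr))
        fromSource (inj₂ (r'' , a , b , q)) = subst (Tin r <_) (sym q)
          (proj₂ g r'' (≤-trans (n≤1+n r) a) (≤-trans (≤-reflexive (+-suc r'' c)) (≤-trans (+-monoˡ-≤ c b) le1)))

      PlusBelowOrZeros : ℕ → Set
      PlusBelowOrZeros r = (Σ ℕ λ r1 → r < r1 × r1 + c ≤ n × D (r1 , suc c) ≡ pls × Tin r1 ≡ Tin r) ⊎
                           (∀ r' → r < r' → r' + c ≤ n → D (r' , suc c) ≡ zer)

      PlusBelowOrZeros-zero : ∀ r → Tin (suc r) ≡ Tin r → D (suc r , suc c) ≡ zer → PlusBelowOrZeros (suc r) → PlusBelowOrZeros r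
      PlusBelowOrZeros-zero r tz _ (inj₁ (r1 , a , b , dp , q)) = inj₁ (r1 , <-trans (n<1+n r) a , b , dp , trans q tz)
      PlusBelowOrZeros-zero r tz eD (inj₂ f) = inj₂ λ r' lt le → nextOrLater r' (≤⇒≡⊎< lt) le
        where
        nextOrLater : ∀ r' → suc r ≡ r' ⊎ suc r < r' → r' + c ≤ n → D (r' , suc c) ≡ zer
        nextOrLater r' (inj₁ refl) _ = eD
        nextOrLater r' (inj₂ lt) le = f r' lt le

      nextPlusBelow : ∀ d r → d + (r + c) ≡ n → m (r , suc c) ≡ true → D (r , suc c) ≡ zer → PlusBelowOrZeros r
      nextPlusBelow zero r eq e eD = inj₂ λ r' lt le → ⊥-elim (1+n≰n (≤-trans (≤-trans (≤-reflexive (cong suc (sym eq))) (+-monoˡ-≤ c lt)) le))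
      nextPlusBelow (suc d) r eq e eD = caseEntry (D (suc r , suc c)) refl
        where
        lt : r + c < n
        lt = ≤-trans (s≤s (m≤n+m (r + c) d)) (≤-reflexive eq)
        caseEntry : ∀ dd → D (suc r , suc c) ≡ dd → PlusBelowOrZeros r
        caseEntry pls eD′ = inj₁ (suc r , ≤-refl , lt , eD′ , Tin-zero r e eD)
        caseEntry zer eD′ = PlusBelowOrZeros-zero r (Tin-zero r e eD) eD′
          (nextPlusBelow d (suc r) (trans (+-suc d (r + c)) eq) (mem-down r (suc r) e (n≤1+n r) lt) eD′)

      Tin-lowerBound : ∀ t → (∀ x → m (x , suc c) ≡ true → t ≤ x) → ∀ r → m (r , suc c) ≡ true → t + c ≤ Tin r
      Tin-lowerBound t lb zero e with proj₁ (rowBounds zero e)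
      ... | ()
      Tin-lowerBound t lb (suc r) e = caseMem (m (r , suc c)) refl
        where
        caseMem : ∀ bb → m (r , suc c) ≡ bb → t + c ≤ Tin (suc r)
        caseMem false e' = subst (t + c ≤_) (sym (Tin-outside r e')) (≤-trans (+-monoˡ-≤ c (lb (suc r) e)) (≤-reflexive (sym (+-suc r c))))
        caseMem true e' = caseEntry (D (r , suc c)) refl
          where
          caseEntry : ∀ dd → D (r , suc c) ≡ dd → t + c ≤ Tin (suc r)
          caseEntry zer eD = subst (t + c ≤_) (sym (Tin-zero r e' eD)) (Tin-lowerBound t lb r e')
          caseEntry pls eD = subst (t + c ≤_) (sym (Tin-plus r e' eD))
            (≤-trans (+-monoʳ-≤ t (n≤1+n c)) (bounded t r (λ x ex → lb x (mem-left x (suc (suc c)) ex (n≤1+n _))) (lb r e')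
               (≤-trans (≤-reflexive (+-suc r c)) (proj₂ (rowBounds (suc r) e))) (proj₁ (rowBounds r e'))))

      rightOf-lowerBound : ColumnValid (suc c) → RightOfBounded c
      rightOf-lowerBound cv t r lb t≤r le 1≤r = caseMem (m (r , suc c)) refl
        where
        caseMem : ∀ bb → m (r , suc c) ≡ bb → t + c ≤ rightOf c r
        caseMem false e = subst (t + c ≤_) (sym (rightOf-outside r 1≤r e)) (+-monoˡ-≤ c t≤r)
        caseMem true e = caseEntry (D (r , suc c)) refl (≤⇒≡⊎< le)
          where
          tl = Tin-lowerBound t lb r e
          caseEntry : ∀ dd → D (r , suc c) ≡ dd → r + c ≡ n ⊎ r + c < n → t + c ≤ rightOf c r
          caseEntry pls eD _ = subst (t + c ≤_) (sym (rightOf-plus r e eD)) tl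
          caseEntry zer eD (inj₁ eq) = subst (t + c ≤_) (sym (rightOf-zeroDiagonal r e eq eD))
            (<⇒≤ (≤-trans (s≤s (≤-trans (+-monoˡ-≤ c t≤r) le)) (n<mirror n (Tin r) (proj₁ (TopGood-all cv r e)))))
          caseEntry zer eD (inj₂ lt) = subst (t + c ≤_) (sym (rightOf-zero r e lt eD))
            (≤-trans (+-monoʳ-≤ t (n≤1+n c)) (bounded t r (λ x ex → lb x (mem-left x (suc (suc c)) ex (n≤1+n _))) t≤r
               (≤-trans (≤-reflexive (+-suc r c)) lt) 1≤r))

      Blocked-weaken : ∀ r → Blocked (suc c) r → Blocked c r
      Blocked-weaken r (C , lt , rest) = C , <-trans (n<1+n c) lt , rest

      Blocked-split : ∀ r → Blocked c r → Blocked (suc c) r ⊎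
        (D (r , suc c) ≡ zer × ((Σ ℕ λ r' → r < r' × m (r' , suc c) ≡ true × D (r' , suc c) ≡ pls) ⊎ IsDiagonal n (r , suc c)))
      Blocked-split r (C , lt , eC , eD , rest) with ≤⇒≡⊎< lt
      ... | inj₁ refl = inj₂ (eD , rest)
      ... | inj₂ lt2 = inj₁ (C , lt2 , eC , eD , rest)

      offDiagonal : ∀ r → r + c < n → ¬ IsDiagonal n (r , suc c)
      offDiagonal r lt eq = <-irrefl (trans (cong (_+_ r) ceq) (m+[n∸m]≡n rn)) lt
        where
        rn : r ≤ n
        rn = ≤-trans (m≤m+n r c) (<⇒≤ lt)
        ceq : c ≡ n ∸ r
        ceq = suc-injective (trans eq (+-comm (n ∸ r) 1))

      diagonal : ∀ r → r + c ≡ n → IsDiagonal n (r , suc c)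
      diagonal r eq = trans (+-comm 1 c) (cong (_+ 1) (sym (trans (cong (_∸ r) (sym eq)) (m+n∸m≡n r c))))

      goodIff¬blocked-outside : ColumnValid (suc c) → ∀ r → 1 ≤ r → r + c ≤ n → m (r , suc c) ≡ false →
        GoodIff¬BlockedAt c r
      goodIff¬blocked-outside cv r 1≤r le e = good⇒iff good nb
        where
        nb : ¬ Blocked c r
        nb (C , lt , eC , _) = true≢false (trans (sym (mem-left r C eC lt)) e)
        Zo = rightOf-outside r 1≤r e
        lb : ∀ x → m (x , suc c) ≡ true → suc r ≤ x
        lb x ex with x ≤? r
        ... | yes x≤r = ⊥-elim (true≢false (trans (sym (mem-down x r ex x≤r le)) e))
        ... | no nx = ≰⇒> nx
        good : Good c r
        good = subst (_≤ n) (sym Zo) le ,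
               λ r' lt le' → subst (_< rightOf c r') (sym Zo) (rightOf-lowerBound cv (suc r) r' lb lt le' (≤-trans (s≤s z≤n) lt))

      goodIff¬blocked-plus : ColumnValid (suc c) → ColumnCondition (suc c) → ∀ r → m (r , suc c) ≡ true →
        D (r , suc c) ≡ pls → GoodIff¬BlockedAt c r
      goodIff¬blocked-plus cv cc r e eD = good⇒iff good nb
        where
        g = TopGood-all cv r e
        Zp = rightOf-plus r e eD
        nb : ¬ Blocked c r
        nb b with Blocked-split r b
        ... | inj₁ b' = zer≢pls (trans (sym (cc r e b')) eD)
        ... | inj₂ (dz , _) = zer≢pls (trans (sym dz) eD)
        gt : ∀ r' → r < r' → r' + c ≤ n → Tin r < rightOf c r'
        gt r' lt le' with D (r' , suc c) in eD' | ≤⇒≡⊎< le'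
        ... | pls | _ = subst (Tin r <_) (sym (rightOf-plus r' m' eD')) (Tin-increasing cv r e eD r' lt le')
          where m' = mem-down r r' e (<⇒≤ lt) le'
        ... | zer | inj₁ eq = subst (Tin r <_) (sym (rightOf-zeroDiagonal r' m' eq eD'))
                (≤-trans (s≤s (proj₁ g)) (n<mirror n (Tin r') (proj₁ (TopGood-all cv r' m'))))
          where m' = mem-down r r' e (<⇒≤ lt) le'
        ... | zer | inj₂ lt' = subst (Tin r <_) (sym (rightOf-zero r' m' lt' eD'))
                (proj₂ g r' (<⇒≤ lt) (≤-trans (≤-reflexive (+-suc r' c)) lt'))
          where m' = mem-down r r' e (<⇒≤ lt) le'
        good : Good c r
        good = subst (_≤ n) (sym Zp) (proj₁ g) , λ r' lt le' → subst (_< rightOf c r') (sym Zp) (gt r' lt le')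

      goodIff¬blocked-zeroDiagonal : ColumnValid (suc c) → ∀ r → m (r , suc c) ≡ true → r + c ≡ n →
        D (r , suc c) ≡ zer → GoodIff¬BlockedAt c r
      goodIff¬blocked-zeroDiagonal cv r e eq eD = blocked⇒iff bl (λ gd → <⇒≱ big (proj₁ gd))
        where
        bl : Blocked c r
        bl = suc c , n<1+n c , e , eD , inj₂ (diagonal r eq)
        big : n < rightOf c r
        big = subst (n <_) (sym (rightOf-zeroDiagonal r e eq eD)) (n<mirror n (Tin r) (proj₁ (TopGood-all cv r e)))

      goodIff¬blocked-zeroAbovePlus : ColumnValid (suc c) → ∀ r → m (r , suc c) ≡ true → r + c < n →
        D (r , suc c) ≡ zer → ∀ r1 → r < r1 → r1 + c ≤ n → D (r1 , suc c) ≡ pls → Tin r1 ≡ Tin r →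
        GoodIff¬BlockedAt c r
      goodIff¬blocked-zeroAbovePlus cv r e lt eD r1 a b dp q = blocked⇒iff bl (λ gd → <-asym (proj₂ gd r1 a b) lt2)
        where
        m1 = mem-down r r1 e (<⇒≤ a) b
        bl : Blocked c r
        bl = suc c , n<1+n c , e , eD , inj₁ (r1 , a , m1 , dp)
        lt2 : rightOf c r1 < rightOf c r
        lt2 = subst₂ _<_ (sym (trans (rightOf-plus r1 m1 dp) q)) (sym (rightOf-zero r e lt eD))
                (proj₂ (TopGood-all cv r e) r ≤-refl (≤-trans (≤-reflexive (+-suc r c)) lt))

      -- Below a 0 with only 0s under it, column suc c passes the inputs of column suc c + 1 through unchanged.
      goodIff¬blocked-zeroAboveZeros : ColumnValid (suc c) → ∀ r → 1 ≤ r → m (r , suc c) ≡ true → r + c < n →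
        D (r , suc c) ≡ zer → (∀ r' → r < r' → r' + c ≤ n → D (r' , suc c) ≡ zer) → GoodIff¬BlockedAt c r
      goodIff¬blocked-zeroAboveZeros cv r 1≤r e lt eD f =
        (λ nb → good← (proj₁ j (λ b → nb (Blocked-weaken r b)))) , (λ gd b → proj₂ j (good→ gd) (blocked→ b))
        where
        Zr = rightOf-zero r e lt eD
        j = goodIff r 1≤r (≤-trans (≤-reflexive (+-suc r c)) lt)
        blocked→ : Blocked c r → Blocked (suc c) r
        blocked→ b with Blocked-split r b
        ... | inj₁ b' = b'
        ... | inj₂ (_ , inj₁ (r' , a , m' , dp)) = ⊥-elim (zer≢pls (trans (sym (f r' a (proj₂ (rowBounds r' m')))) dp))
        ... | inj₂ (_ , inj₂ dg) = ⊥-elim (offDiagonal r lt dg)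
        good→ : Good c r → Good (suc c) r
        good→ gd = subst (_≤ n) Zr (proj₁ gd) , λ r' a le' →
          subst₂ _<_ Zr (rightOf-zero r' (mem-down r r' e (<⇒≤ a) (lc r' le')) (lc' r' le') (f r' a (lc r' le'))) (proj₂ gd r' a (lc r' le'))
          where
          lc' : ∀ r' → r' + suc c ≤ n → r' + c < n
          lc' r' le' = ≤-trans (≤-reflexive (sym (+-suc r' c))) le'
          lc : ∀ r' → r' + suc c ≤ n → r' + c ≤ n
          lc r' le' = <⇒≤ (lc' r' le')
        good← : Good (suc c) r → Good c r
        good← gd = subst (_≤ n) (sym Zr) (proj₁ gd) , λ r' a le' → below r' a (≤⇒≡⊎< le')
          where
          below : ∀ r' → r < r' → r' + c ≡ n ⊎ r' + c < n → rightOf c r < rightOf c r'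
          below r' a (inj₁ eq) = subst₂ _<_ (sym Zr) (sym (rightOf-zeroDiagonal r' m' eq (f r' a (≤-reflexive eq))))
              (≤-trans (s≤s (proj₁ gd)) (n<mirror n (Tin r') (proj₁ (TopGood-all cv r' m'))))
            where m' = mem-down r r' e (<⇒≤ a) (≤-reflexive eq)
          below r' a (inj₂ lt') = subst₂ _<_ (sym Zr) (sym (rightOf-zero r' m' lt' (f r' a (<⇒≤ lt'))))
              (proj₂ gd r' a (≤-trans (≤-reflexive (+-suc r' c)) lt'))
            where m' = mem-down r r' e (<⇒≤ a) (<⇒≤ lt')

      goodIff¬blocked : ColumnValid (suc c) → ColumnCondition (suc c) → GoodIff¬Blocked c
      goodIff¬blocked cv cc r 1≤r le with m (r , suc c) in e
      ... | false = goodIff¬blocked-outside cv r 1≤r le e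
      ... | true with D (r , suc c) in eD | ≤⇒≡⊎< le
      ...   | pls | _ = goodIff¬blocked-plus cv cc r e eD
      ...   | zer | inj₁ eq = goodIff¬blocked-zeroDiagonal cv r e eq eD
      ...   | zer | inj₂ lt with nextPlusBelow (n ∸ (r + c)) r (m∸n+n≡m le) e eD
      ...     | inj₁ (r1 , a , b , dp , q) = goodIff¬blocked-zeroAbovePlus cv r e lt eD r1 a b dp q
      ...     | inj₂ f = goodIff¬blocked-zeroAboveZeros cv r 1≤r e lt eD f

  ValidFrom : ℕ → Set
  ValidFrom c = ∀ c' → c < c' → c' ≤ n → ColumnValid c'

  ConditionFrom : ℕ → Set
  ConditionFrom c = ∀ c' → c < c' → c' ≤ n → ColumnCondition c'

  Invariant : ℕ → Set
  Invariant c = (ValidFrom c ⇔ ConditionFrom c) × (ConditionFrom c → GoodIff¬Blocked c × RightOfBounded c)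

  invariant-n : Invariant n
  invariant-n = mk⇔ (λ _ c' lt le → ⊥-elim (<⇒≱ lt le)) (λ _ c' lt le → ⊥-elim (<⇒≱ lt le)) ,
          λ _ → (λ r 1≤r le → ⊥-elim (1+n≰n (≤-trans (+-monoˡ-≤ n 1≤r) le))) ,
                (λ t r _ _ le 1≤r → ⊥-elim (1+n≰n (≤-trans (+-monoˡ-≤ n 1≤r) le)))

  -- Sweeping the columns from right to left: once the columns right of c satisfy their
  -- conditions, the values entering column c are good exactly in the unblocked rows.
  invariant-step : ∀ c → c < n → Invariant (suc c) → Invariant c
  invariant-step c c<n (valid⇔cond , facts) = mk⇔ valid⇒cond cond⇒valid , localFacts
    where
    open Column c c<n
    later : ∀ {P : ℕ → Set} → (∀ c' → c < c' → c' ≤ n → P c') → ∀ c' → suc c < c' → c' ≤ n → P c'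
    later f c' lt = f c' (<-trans (n<1+n c) lt)
    extend : ∀ {P : ℕ → Set} → P (suc c) → (∀ c' → suc c < c' → c' ≤ n → P c') → ∀ c' → c < c' → c' ≤ n → P c'
    extend p q c' lt le with ≤⇒≡⊎< lt
    ... | inj₁ refl = p
    ... | inj₂ lt2 = q c' lt2 le
    column : ConditionFrom (suc c) → ColumnValid (suc c) ⇔ ColumnCondition (suc c)
    column cond = FromRight.ColumnValid⇔ColumnCondition (proj₁ (facts cond)) (proj₂ (facts cond))
    valid⇒cond : ValidFrom c → ConditionFrom c
    valid⇒cond valid = extend (Equivalence.to (column cond) (valid (suc c) (n<1+n c) c<n)) cond
      where cond = Equivalence.to valid⇔cond (later valid)
    cond⇒valid : ConditionFrom c → ValidFrom c
    cond⇒valid cond =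
      extend (Equivalence.from (column (later cond)) (cond (suc c) (n<1+n c) c<n)) (Equivalence.from valid⇔cond (later cond))
    localFacts : ConditionFrom c → GoodIff¬Blocked c × RightOfBounded c
    localFacts cond = FromRight.goodIff¬blocked goodIff bounded valid here , FromRight.rightOf-lowerBound goodIff bounded valid
      where
      goodIff = proj₁ (facts (later cond))
      bounded = proj₂ (facts (later cond))
      here = cond (suc c) (n<1+n c) c<n
      valid = Equivalence.from (column (later cond)) here

  invariant : ∀ d c → d + c ≡ n → Invariant c
  invariant zero c refl = invariant-n
  invariant (suc d) c eq = invariant-step c (≤-trans (s≤s (m≤n+m c d)) (≤-reflexive eq)) (invariant d (suc c) (trans (+-suc d c) eq))

  allValid⇔allConditions : (∀ y → m y ≡ true → Valid y) ⇔ ConditionFrom 0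
  allValid⇔allConditions = mk⇔ (λ v → Equivalence.to e (λ c' _ _ r er → v (r , c') er))
                (λ ac y ey → validAt y ey (Equivalence.from e ac))
    where
    e = proj₁ (invariant n 0 (+-identityʳ n))
    validAt : ∀ y → m y ≡ true → ValidFrom 0 → Valid y
    validAt (r , c') ey av with mem⇒InQ′ r c' ey
    ... | 1≤r , 1≤c , le = av c' 1≤c (≤-pred (≤-trans (+-monoˡ-≤ c' 1≤r) le)) r ey

module OrderIdeal (n : ℕ) (O : Box → Set) (ideal : IsOrderIdeal n O) (L : List Box) (ext : IsLinearExt n O L) where
  open import Data.Fin as Fin using (Fin)
  open import Data.List using (reverse; lookup)
  open import Data.List.Relation.Unary.Any using (index)
  open import Data.List.Relation.Unary.Any.Properties using (reverse⁺; reverse⁻; lookup-index)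
  open import Data.List.Membership.Propositional using (_∈_)
  open StaircaseOrder n using (_<Q_; ≤Q-coordinatewise; toQ′)
  open BoxLists n

  S : List Box
  S = reverse L

  ∈S⇒O : ∀ y → y ∈ S → O y
  ∈S⇒O y m = Equivalence.to (proj₁ (proj₂ ext) y) (reverse⁻ m)

  O⇒∈S : ∀ y → O y → y ∈ S
  O⇒∈S y o = reverse⁺ (Equivalence.from (proj₁ (proj₂ ext) y) o)

  mem⇒O : ∀ y → mem S y ≡ true → O y
  mem⇒O y e = ∈S⇒O y (mem-true⁻ S y e)

  O⇒mem : ∀ y → O y → mem S y ≡ true
  O⇒mem y o = mem-true S y (O⇒∈S y o)

  S-insideQ : InsideQ S
  S-insideQ y m = proj₁ ideal y (∈S⇒O y m)

  S-downClosed : DownClosed S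
  S-downClosed x y m lt = O⇒∈S x (proj₂ ideal x y (∈S⇒O y m) lt)

  noLaterBelow : ∀ L′ → (∀ (i j : Fin (length L′)) → lookup L′ i <Q lookup L′ j → i Fin.< j) → NoLaterBelow L′
  noLaterBelow [] _ = tt
  noLaterBelow (x ∷ L′) ordered =
    (λ y m lt → Fin-<0 (ordered (Fin.suc (index m)) Fin.zero (subst (_<Q x) (lookup-index m) lt))) ,
    noLaterBelow L′ (λ i j lt → ≤-pred (ordered (Fin.suc i) (Fin.suc j) lt))
    where
    Fin-<0 : ∀ {k} → suc k < 0 → ⊥
    Fin-<0 ()

  S-maximalFirst : MaximalFirst S
  S-maximalFirst = MaximalFirst-reverse L (proj₁ ext) (noLaterBelow L (proj₂ (proj₂ ext)))

  mem-inQ : ∀ r c → mem S (r , c) ≡ true → InQ n (r , c)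
  mem-inQ r c e = S-insideQ _ (mem-true⁻ S _ e)

  mem-downward : ∀ r c r' c' → mem S (r , c) ≡ true → InQ n (r' , c') → r ≤ r' → c' ≤ c → mem S (r' , c') ≡ true
  mem-downward r c r' c' e q le1 le2 with ≤Q-coordinatewise r' c' r c (toQ′ q) (toQ′ (mem-inQ r c e)) le1 le2
  ... | inj₁ eq = subst (λ y → mem S y ≡ true) (sym eq) e
  ... | inj₂ lt = mem-true S _ (S-downClosed _ _ (mem-true⁻ S _ e) lt)

  column-bounds : ∀ r c → O (r , c) → 0 < c × c ≤ n
  column-bounds r c o with toQ′ (proj₁ ideal _ o)
  ... | 1≤r , 1≤c , le = 1≤c , ≤-pred (≤-trans (+-monoˡ-≤ c 1≤r) le)

  conditions⇔Cond1×Cond2 : ∀ D (β : ℕ → ℕ) (β≡id : ∀ q → β q ≡ q) →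
    Columns.ConditionFrom n D (mem S) β β≡id mem-inQ mem-downward 0 ⇔ (Cond1 n O D × Cond2 n O D)
  conditions⇔Cond1×Cond2 D β β≡id = mk⇔ to from
    where
    open Columns n D (mem S) β β≡id mem-inQ mem-downward using (ConditionFrom)
    to : ConditionFrom 0 → Cond1 n O D × Cond2 n O D
    to cond = (λ r r' c z isZero r'c r<r' isPlus c' c'<c z' →
                 cond c' (proj₁ (column-bounds r c' z')) (proj₂ (column-bounds r c' z')) r (O⇒mem _ z')
                   (c , c'<c , O⇒mem _ z , isZero , inj₁ (r' , r<r' , O⇒mem _ r'c , isPlus))) ,
              (λ r c z diag isZero c' c'<c z' →
                 cond c' (proj₁ (column-bounds r c' z')) (proj₂ (column-bounds r c' z')) r (O⇒mem _ z')
                   (c , c'<c , O⇒mem _ z , isZero , inj₂ diag))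
    from : Cond1 n O D × Cond2 n O D → ConditionFrom 0
    from (cond1 , _) c' _ _ r e (C , lt , eC , isZero , inj₁ (r' , lt' , e' , isPlus)) =
      cond1 r r' C (mem⇒O _ eC) isZero (mem⇒O _ e') lt' isPlus c' lt (mem⇒O _ e)
    from (_ , cond2) c' _ _ r e (C , lt , eC , isZero , inj₂ diag) =
      cond2 r C (mem⇒O _ eC) diag isZero c' lt (mem⇒O _ e)

mainTheorem4 : (n : ℕ) → 2 ≤ n → (O : Box → Set) → IsOrderIdeal n O →
    (D : Box → Entry) → (L : List Box) → IsLinearExt n O L →
    IsΓDiagram n D L ⇔ (Cond1 n O D × Cond2 n O D)
mainTheorem4 n _ O ideal D L ext =
  ⇔-trans (gammaSteps⇔allValid S (idW n) S-insideQ S-downClosed S-maximalFirst IsSignedPerm-idW)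
    (⇔-trans (All⇔∀mem S)
      (⇔-trans allValid⇔allConditions (conditions⇔Cond1×Cond2 D (ranks (idW n)) ranks-idW)))
  where
  open SignedPermutation n using (ranks; ranks-idW; IsSignedPerm-idW)
  open BoxLists n using (mem; All⇔∀mem)
  open OrderIdeal n O ideal L ext
  open Processing n D using (gammaSteps⇔allValid)
  open Columns n D (mem S) (ranks (idW n)) ranks-idW mem-inQ mem-downward using (allValid⇔allConditions)
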